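{- The following hold: $$F_{123}(x,q)=1+\frac{xq}{1-x}+\frac{x^2q^2}{(1-x)^3},\qquad F_{132}(x,q)=F_{213}(x,q)=F_{231}(x,q)=\frac{1-x}{1-x-xq},$$ $$F_{321}(x,q)=\frac{1-xq}{(1-xq)^2-x^2q}.$$
   Context: For $\tau\in S_k(312)$, $F_\tau(x,q)=\sum_{n\geq0}\sum_{\sigma\in S_n(312,\tau)}x^nq^{L_n(\sigma)}$, where $S_n(312,\tau)$ is the set of permutations of $[n]$ avoiding the patterns $312$ and $\tau$ (the empty permutation counted for $n=0$), and $L_n(\sigma)$ is the length of a longest increasing subsequence of $\sigma$ ($0$ for the empty permutation). -}

module Defs where

open import Data.Bool using (Bool; true; false; _∧_; not; _xor_)
open import Data.Nat using (ℕ; zero; suc; _<ᵇ_; _≡ᵇ_; _⊔_)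
open import Data.List using (List; []; _∷_; map; concatMap; upTo; filterᵇ; length; foldr; zip)
open import Data.Bool.ListAction using (any; all)
open import Data.Product using (_,_; uncurry)
open import Data.Integer using (ℤ; +_; -_) renaming (_+_ to _+ℤ_; _*_ to _*ℤ_)
open import Relation.Binary.PropositionalEquality using (_≡_)

-- Permutations of [n], represented (0-based) as lists of length n over
-- {0,…,n-1} with pairwise distinct entries.  Only the relative order of
-- entries matters for pattern containment and increasing subsequences.

words : ℕ → ℕ → List (List ℕ)
words zero    m = [] ∷ []
words (suc l) m = concatMap (λ w → map (_∷ w) (upTo m)) (words l m)

distinct : List ℕ → Bool
distinct []       = true
distinct (a ∷ as) = not (any (λ b → a ≡ᵇ b) as) ∧ distinct as

perms : ℕ → List (List ℕ)
perms n = filterᵇ distinct (words n n)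

subseqs : List ℕ → List (List ℕ)
subseqs []       = [] ∷ []
subseqs (a ∷ as) = let r = subseqs as in map (a ∷_) r Data.List.++ r

orderIso : List ℕ → List ℕ → Bool
orderIso []       []       = true
orderIso (a ∷ as) (b ∷ bs) =
  all (uncurry λ a′ b′ → not ((a <ᵇ a′) xor (b <ᵇ b′))) (zip as bs) ∧ orderIso as bs
orderIso _ _ = false

contains : List ℕ → List ℕ → Bool
contains σ τ = any (orderIso τ) (subseqs σ)

avoids : List ℕ → List ℕ → Bool
avoids σ τ = not (contains σ τ)

increasing : List ℕ → Bool
increasing []           = true
increasing (a ∷ [])     = true
increasing (a ∷ b ∷ r)  = (a <ᵇ b) ∧ increasing (b ∷ r)

lis : List ℕ → ℕ
lis σ = foldr _⊔_ 0 (map length (filterᵇ increasing (subseqs σ)))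

p312 : List ℕ
p312 = 3 ∷ 1 ∷ 2 ∷ []

count : List ℕ → ℕ → ℕ → ℕ
count τ n k = length (filterᵇ (λ σ → avoids σ p312 ∧ avoids σ τ ∧ (lis σ ≡ᵇ k)) (perms n))

-- Formal power series in x, q with integer coefficients:
-- s n k is the coefficient of x^n q^k.

Series : Set
Series = ℕ → ℕ → ℤ

F : List ℕ → Series
F τ n k = + count τ n k

sumTo : (ℕ → ℤ) → ℕ → ℤ
sumTo f zero    = f zero
sumTo f (suc n) = sumTo f n +ℤ f (suc n)

infixl 6 _⊕_ _⊖_
infixl 7 _⊗_

_⊕_ : Series → Series → Series
(f ⊕ g) n k = f n k +ℤ g n k

_⊖_ : Series → Series → Series
(f ⊖ g) n k = f n k +ℤ (- g n k)

_⊗_ : Series → Series → Series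
(f ⊗ g) n k = sumTo (λ i → sumTo (λ j → f i j *ℤ g (n Data.Nat.∸ i) (k Data.Nat.∸ j)) k) n

𝟙 : Series
𝟙 zero zero = + 1
𝟙 _    _    = + 0

X : Series
X (suc zero) zero = + 1
X _          _    = + 0

Q : Series
Q zero (suc zero) = + 1
Q _    _          = + 0

_≐_ : Series → Series → Set
f ≐ g = ∀ n k → f n k ≡ g n k
infix 4 _≐_

module Submission where

-- Write c(n, k) for the number of σ ∈ S_n(312, τ) with L_n(σ) = k.  For each τ, every
-- σ ∈ S_{n+1}(312, τ) arises in exactly one way from some ρ ∈ S_n(312, τ) by one of two
-- insertions of a new entry, and each insertion changes L in a known way.  This gives
-- c(n+1, k) = c(n, k) + c(n, k-1) for τ = 132, 213, 231; a pair of coupled recurrences for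
-- τ = 321, which also track L of σ with its last entry removed; and for τ = 123 the closed
-- form c(n, 1) = 1, c(n, 2) = n(n-1)/2, c(n, k) = 0 for k ≥ 3 (n ≥ 1).  Multiplying a
-- series by x or by q shifts its coefficients, so each claimed identity, read
-- coefficientwise, is exactly the corresponding recurrence.

open import Defs
open import Data.Bool using (Bool; true; false; _∧_; _xor_; not; T; if_then_else_)
open import Data.Bool.Properties using (∧-assoc)
open import Data.Bool.ListAction using (any)
open import Data.Empty using (⊥; ⊥-elim)
open import Data.List using (List; []; _∷_; _++_; map; length; filterᵇ; foldr; upTo; [_]; concatMap)
open import Data.List.Properties
  using (∷-injective; map-injective; ++-assoc; length-map; ∷ʳ-injectiveˡ; ∷ʳ-injectiveʳ; ++-identityʳ; map-∘; length-upTo)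
open import Data.List.Membership.Propositional using (_∈_; _∉_; find; lose)
open import Data.List.Membership.Propositional.Properties
open import Data.List.Membership.Propositional.Properties.WithK using (unique∧set⇒bag)
open import Data.List.Relation.Binary.BagAndSetEquality using (∼bag⇒↭)
open import Data.List.Relation.Binary.Disjoint.Propositional using (Disjoint)
open import Data.List.Relation.Binary.Permutation.Propositional using (_↭_)
open import Data.List.Relation.Binary.Permutation.Propositional.Properties using (↭-length; filter-↭)
open import Data.List.Relation.Unary.All as All using (All; []; _∷_)
import Data.List.Relation.Unary.All.Properties as Allₚ
open import Data.List.Relation.Unary.All.Properties using (¬Any⇒All¬; All¬⇒¬Any)
open import Data.List.Relation.Unary.AllPairs using ([]; _∷_)
open import Data.List.Relation.Unary.Any using (here; there)
open import Data.List.Relation.Unary.Unique.Propositional using (Unique)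
import Data.List.Relation.Unary.Unique.Propositional.Properties as UP
open import Data.Nat using (ℕ; zero; suc; _≤_; _<_; z≤n; s≤s; s≤s⁻¹; _<ᵇ_; _≡ᵇ_; _⊔_; pred; _+_; _∸_; _≟_; z<s)
open import Data.Nat.Properties
open import Data.Product using (Σ; _×_; _,_; proj₁; proj₂)
open import Data.Sum using (_⊎_; inj₁; inj₂)
open import Data.Unit using (tt)
open import Function.Base using (_∘_)
open import Function.Bundles using (mk⇔)
open import Level using (0ℓ)
open import Relation.Binary.Bundles using (Setoid)
open import Relation.Binary.Definitions using (tri<; tri≈; tri>)
open import Relation.Binary.PropositionalEquality hiding ([_])
open import Relation.Binary.Structures using (IsEquivalence)
open import Relation.Nullary using (yes; no)
open import Relation.Nullary.Decidable.Core using (T?)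
open import Data.List.Membership.DecPropositional _≟_ using (_∈?_)

module PowerSeries where

  open import Data.Integer using (ℤ; +_; -_) renaming (_+_ to _+ℤ_; _*_ to _*ℤ_)
  import Data.Integer.Properties as ℤ
  open import Data.Integer.Solver using (module +-*-Solver)
  open +-*-Solver using (solve; _:+_; _:*_; :-_; _:=_; con)

  infixr 8 x·_ q·_

  x·_ : Series → Series
  (x· A) zero    k = + 0
  (x· A) (suc n) k = A n k

  q·_ : Series → Series
  (q· A) n zero    = + 0
  (q· A) n (suc k) = A n k

  Δ ∇ : Series → Series
  Δ A = A ⊖ x· A
  ∇ A = A ⊖ q· x· A

  ≐-isEquivalence : IsEquivalence _≐_
  ≐-isEquivalence = record
    { refl  = λ _ _ → refl
    ; sym   = λ e n k → sym (e n k)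
    ; trans = λ e f n k → trans (e n k) (f n k)
    }

  ≐-setoid : Setoid 0ℓ 0ℓ
  ≐-setoid = record { isEquivalence = ≐-isEquivalence }

  sumTo-cong : ∀ {f g : ℕ → ℤ} n → (∀ i → i ≤ n → f i ≡ g i) → sumTo f n ≡ sumTo g n
  sumTo-cong zero    f≗g = f≗g zero z≤n
  sumTo-cong (suc n) f≗g = cong₂ _+ℤ_ (sumTo-cong n λ i i≤n → f≗g i (m≤n⇒m≤1+n i≤n)) (f≗g (suc n) ≤-refl)

  sumTo-zeros : ∀ {f : ℕ → ℤ} n → (∀ i → i ≤ n → f i ≡ + 0) → sumTo f n ≡ + 0
  sumTo-zeros zero    f≗0 = f≗0 zero z≤n
  sumTo-zeros (suc n) f≗0
    rewrite sumTo-zeros n (λ i i≤n → f≗0 i (m≤n⇒m≤1+n i≤n)) | f≗0 (suc n) ≤-refl = refl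

  sumTo-last : ∀ {f : ℕ → ℤ} n → (∀ i → i < n → f i ≡ + 0) → sumTo f n ≡ f n
  sumTo-last zero    _   = refl
  sumTo-last (suc n) f≗0 rewrite sumTo-zeros n (λ i i≤n → f≗0 i (s≤s i≤n)) = ℤ.+-identityˡ _

  sumTo-⊖ : ∀ (f g : ℕ → ℤ) n → sumTo (λ i → f i +ℤ - g i) n ≡ sumTo f n +ℤ - sumTo g n
  sumTo-⊖ f g zero    = refl
  sumTo-⊖ f g (suc n) rewrite sumTo-⊖ f g n =
    solve 4 (λ a b c d → a :+ :- b :+ (c :+ :- d) := a :+ c :+ :- (b :+ d)) refl
      (sumTo f n) (sumTo g n) (f (suc n)) (g (suc n))

  ⊗-congʳ : ∀ A {B C} → B ≐ C → A ⊗ B ≐ A ⊗ C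
  ⊗-congʳ A B≐C n k = sumTo-cong n λ i _ → sumTo-cong k λ j _ → cong (A i j *ℤ_) (B≐C (n ∸ i) (k ∸ j))

  ⊗-congˡ : ∀ {A B} C → A ≐ B → A ⊗ C ≐ B ⊗ C
  ⊗-congˡ C A≐B n k = sumTo-cong n λ i _ → sumTo-cong k λ j _ → cong (_*ℤ C (n ∸ i) (k ∸ j)) (A≐B i j)

  ⊕-cong : ∀ {A B C D} → A ≐ B → C ≐ D → A ⊕ C ≐ B ⊕ D
  ⊕-cong A≐B C≐D n k = cong₂ _+ℤ_ (A≐B n k) (C≐D n k)

  ⊖-cong : ∀ {A B C D} → A ≐ B → C ≐ D → A ⊖ C ≐ B ⊖ D
  ⊖-cong A≐B C≐D n k = cong₂ (λ a c → a +ℤ - c) (A≐B n k) (C≐D n k)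

  x·-cong : ∀ {A B} → A ≐ B → x· A ≐ x· B
  x·-cong A≐B zero    k = refl
  x·-cong A≐B (suc n) k = A≐B n k

  q·-cong : ∀ {A B} → A ≐ B → q· A ≐ q· B
  q·-cong A≐B n zero    = refl
  q·-cong A≐B n (suc k) = A≐B n k

  Δ-cong : ∀ {A B} → A ≐ B → Δ A ≐ Δ B
  Δ-cong A≐B = ⊖-cong A≐B (x·-cong A≐B)

  ∇-cong : ∀ {A B} → A ≐ B → ∇ A ≐ ∇ B
  ∇-cong A≐B = ⊖-cong A≐B (q·-cong (x·-cong A≐B))

  ⊗-distribˡ-⊖ : ∀ A B C → A ⊗ (B ⊖ C) ≐ A ⊗ B ⊖ A ⊗ C
  ⊗-distribˡ-⊖ A B C n k = trans (sumTo-cong n λ i _ → row i) (sumTo-⊖ _ _ n)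
    where
    distrib : ∀ a b c → a *ℤ (b +ℤ - c) ≡ a *ℤ b +ℤ - (a *ℤ c)
    distrib = solve 3 (λ a b c → a :* (b :+ :- c) := a :* b :+ :- (a :* c)) refl
    row : ∀ i → sumTo (λ j → A i j *ℤ (B (n ∸ i) (k ∸ j) +ℤ - C (n ∸ i) (k ∸ j))) k
              ≡ sumTo (λ j → A i j *ℤ B (n ∸ i) (k ∸ j)) k +ℤ - sumTo (λ j → A i j *ℤ C (n ∸ i) (k ∸ j)) k
    row i = trans (sumTo-cong k λ j _ → distrib (A i j) _ _) (sumTo-⊖ _ _ k)

  ⊗-identityʳ : ∀ A → A ⊗ 𝟙 ≐ A
  ⊗-identityʳ A n k = trans (sumTo-last n earlierRows) (trans (sumTo-last k earlierColumns) lastTerm)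
    where
    earlierRows : ∀ i → i < n → sumTo (λ j → A i j *ℤ 𝟙 (n ∸ i) (k ∸ j)) k ≡ + 0
    earlierRows i (s≤s i≤n) rewrite +-∸-assoc 1 i≤n = sumTo-zeros k λ j _ → ℤ.*-zeroʳ (A i j)
    earlierColumns : ∀ j → j < k → A n j *ℤ 𝟙 (n ∸ n) (k ∸ j) ≡ + 0
    earlierColumns j (s≤s j≤k) rewrite n∸n≡0 n | +-∸-assoc 1 j≤k = ℤ.*-zeroʳ (A n j)
    lastTerm : A n k *ℤ 𝟙 (n ∸ n) (k ∸ k) ≡ A n k
    lastTerm rewrite n∸n≡0 n | n∸n≡0 k = ℤ.*-identityʳ (A n k)

  ⊗-x· : ∀ A B → A ⊗ x· B ≐ x· (A ⊗ B)
  ⊗-x· A B zero    k = sumTo-zeros k λ j _ → ℤ.*-zeroʳ (A 0 j)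
  ⊗-x· A B (suc n) k =
    trans (cong (sumTo row n +ℤ_) lastRowVanishes) (trans (ℤ.+-identityʳ _) (sumTo-cong n shiftRow))
    where
    row : ℕ → ℤ
    row i = sumTo (λ j → A i j *ℤ (x· B) (suc n ∸ i) (k ∸ j)) k
    lastRowVanishes : sumTo (λ j → A (suc n) j *ℤ (x· B) (n ∸ n) (k ∸ j)) k ≡ + 0
    lastRowVanishes rewrite n∸n≡0 n = sumTo-zeros k λ j _ → ℤ.*-zeroʳ (A (suc n) j)
    shiftRow : ∀ i → i ≤ n → sumTo (λ j → A i j *ℤ (x· B) (suc n ∸ i) (k ∸ j)) k
                             ≡ sumTo (λ j → A i j *ℤ B (n ∸ i) (k ∸ j)) k
    shiftRow i i≤n = sumTo-cong k λ j _ → cong (λ m → A i j *ℤ (x· B) m (k ∸ j)) (+-∸-assoc 1 i≤n)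

  ⊗-q· : ∀ A B → A ⊗ q· B ≐ q· (A ⊗ B)
  ⊗-q· A B n zero    = sumTo-zeros n λ i _ → ℤ.*-zeroʳ (A i 0)
  ⊗-q· A B n (suc k) = sumTo-cong n λ i _ →
    trans (cong (sumTo (λ j → A i j *ℤ (q· B) (n ∸ i) (suc k ∸ j)) k +ℤ_) (lastColumnVanishes i))
          (trans (ℤ.+-identityʳ _) (sumTo-cong k (shiftColumn i)))
    where
    lastColumnVanishes : ∀ i → A i (suc k) *ℤ (q· B) (n ∸ i) (k ∸ k) ≡ + 0
    lastColumnVanishes i rewrite n∸n≡0 k = ℤ.*-zeroʳ (A i (suc k))
    shiftColumn : ∀ i j → j ≤ k → A i j *ℤ (q· B) (n ∸ i) (suc k ∸ j) ≡ A i j *ℤ B (n ∸ i) (k ∸ j)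
    shiftColumn i j j≤k = cong (λ m → A i j *ℤ (q· B) (n ∸ i) m) (+-∸-assoc 1 j≤k)

  X≐x·𝟙 : X ≐ x· 𝟙
  X≐x·𝟙 zero                k       = refl
  X≐x·𝟙 (suc zero)          zero    = refl
  X≐x·𝟙 (suc zero)          (suc k) = refl
  X≐x·𝟙 (suc (suc n))       k       = refl

  Q≐q·𝟙 : Q ≐ q· 𝟙
  Q≐q·𝟙 zero    zero          = refl
  Q≐q·𝟙 zero    (suc zero)    = refl
  Q≐q·𝟙 zero    (suc (suc k)) = refl
  Q≐q·𝟙 (suc n) zero          = refl
  Q≐q·𝟙 (suc n) (suc zero)    = refl
  Q≐q·𝟙 (suc n) (suc (suc k)) = refl

  open Setoid ≐-setoid using () renaming (refl to ≐-refl)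
  open import Relation.Binary.Reasoning.Setoid ≐-setoid

  ⊗-X : ∀ A → A ⊗ X ≐ x· A
  ⊗-X A = begin
    A ⊗ X       ≈⟨ ⊗-congʳ A X≐x·𝟙 ⟩
    A ⊗ x· 𝟙    ≈⟨ ⊗-x· A 𝟙 ⟩
    x· (A ⊗ 𝟙)  ≈⟨ x·-cong (⊗-identityʳ A) ⟩
    x· A        ∎

  ⊗-Q : ∀ A → A ⊗ Q ≐ q· A
  ⊗-Q A = begin
    A ⊗ Q       ≈⟨ ⊗-congʳ A Q≐q·𝟙 ⟩
    A ⊗ q· 𝟙    ≈⟨ ⊗-q· A 𝟙 ⟩
    q· (A ⊗ 𝟙)  ≈⟨ q·-cong (⊗-identityʳ A) ⟩
    q· A        ∎

  ⊗-XQ : ∀ A → A ⊗ (X ⊗ Q) ≐ q· x· A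
  ⊗-XQ A = begin
    A ⊗ (X ⊗ Q)  ≈⟨ ⊗-congʳ A (⊗-Q X) ⟩
    A ⊗ q· X     ≈⟨ ⊗-q· A X ⟩
    q· (A ⊗ X)   ≈⟨ q·-cong (⊗-X A) ⟩
    q· x· A      ∎

  ⊗-XXQ : ∀ A → A ⊗ (X ⊗ X ⊗ Q) ≐ q· x· x· A
  ⊗-XXQ A = begin
    A ⊗ (X ⊗ X ⊗ Q)  ≈⟨ ⊗-congʳ A (⊗-Q (X ⊗ X)) ⟩
    A ⊗ q· (X ⊗ X)   ≈⟨ ⊗-congʳ A (q·-cong (⊗-X X)) ⟩
    A ⊗ q· x· X      ≈⟨ ⊗-q· A (x· X) ⟩
    q· (A ⊗ x· X)    ≈⟨ q·-cong (⊗-x· A X) ⟩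
    q· x· (A ⊗ X)    ≈⟨ q·-cong (x·-cong (⊗-X A)) ⟩
    q· x· x· A       ∎

  ⊗-𝟙⊖X : ∀ A → A ⊗ (𝟙 ⊖ X) ≐ Δ A
  ⊗-𝟙⊖X A = begin
    A ⊗ (𝟙 ⊖ X)    ≈⟨ ⊗-distribˡ-⊖ A 𝟙 X ⟩
    A ⊗ 𝟙 ⊖ A ⊗ X  ≈⟨ ⊖-cong (⊗-identityʳ A) (⊗-X A) ⟩
    Δ A            ∎

  ⊗-𝟙⊖XQ : ∀ A → A ⊗ (𝟙 ⊖ X ⊗ Q) ≐ ∇ A
  ⊗-𝟙⊖XQ A = begin
    A ⊗ (𝟙 ⊖ X ⊗ Q)        ≈⟨ ⊗-distribˡ-⊖ A 𝟙 (X ⊗ Q) ⟩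
    A ⊗ 𝟙 ⊖ A ⊗ (X ⊗ Q)    ≈⟨ ⊖-cong (⊗-identityʳ A) (⊗-XQ A) ⟩
    ∇ A                    ∎

  ⊗-⊗-𝟙⊖X : ∀ A B → A ⊗ (B ⊗ (𝟙 ⊖ X)) ≐ Δ (A ⊗ B)
  ⊗-⊗-𝟙⊖X A B = begin
    A ⊗ (B ⊗ (𝟙 ⊖ X))   ≈⟨ ⊗-congʳ A (⊗-𝟙⊖X B) ⟩
    A ⊗ (B ⊖ x· B)      ≈⟨ ⊗-distribˡ-⊖ A B (x· B) ⟩
    A ⊗ B ⊖ A ⊗ x· B    ≈⟨ ⊖-cong (≐-refl {A ⊗ B}) (⊗-x· A B) ⟩
    Δ (A ⊗ B)           ∎

  ⊗-⊗-𝟙⊖XQ : ∀ A B → A ⊗ (B ⊗ (𝟙 ⊖ X ⊗ Q)) ≐ ∇ (A ⊗ B)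
  ⊗-⊗-𝟙⊖XQ A B = begin
    A ⊗ (B ⊗ (𝟙 ⊖ X ⊗ Q))  ≈⟨ ⊗-congʳ A (⊗-𝟙⊖XQ B) ⟩
    A ⊗ (B ⊖ q· x· B)      ≈⟨ ⊗-distribˡ-⊖ A B (q· x· B) ⟩
    A ⊗ B ⊖ A ⊗ q· x· B    ≈⟨ ⊖-cong (≐-refl {A ⊗ B}) (⊗-q· A (x· B)) ⟩
    A ⊗ B ⊖ q· (A ⊗ x· B)  ≈⟨ ⊖-cong (≐-refl {A ⊗ B}) (q·-cong (⊗-x· A B)) ⟩
    ∇ (A ⊗ B)              ∎

  module PascalRecurrence (c : ℕ → ℕ → ℕ)
    (c₀₀ : c 0 0 ≡ 1) (c₀ₛ : ∀ k → c 0 (suc k) ≡ 0)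
    (c₁₀ : c 1 0 ≡ 0) (c₁₁ : c 1 1 ≡ 1) (c₁ₛₛ : ∀ k → c 1 (suc (suc k)) ≡ 0)
    (step : ∀ n → 1 ≤ n → (c (suc n) 0 ≡ c n 0) × (∀ k → c (suc n) (suc k) ≡ c n (suc k) + c n k)) where

    G : Series
    G n k = + c n k

    coefficients : Δ G ⊖ q· x· G ≐ 𝟙 ⊖ X
    coefficients zero          zero          rewrite c₀₀ = refl
    coefficients zero          (suc k)       rewrite c₀ₛ k = refl
    coefficients (suc zero)    zero          rewrite c₁₀ | c₀₀ = refl
    coefficients (suc zero)    (suc zero)    rewrite c₁₁ | c₀₀ | c₀ₛ 0 = refl
    coefficients (suc zero)    (suc (suc k)) rewrite c₁ₛₛ k | c₀ₛ k | c₀ₛ (suc k) = refl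
    coefficients (suc (suc n)) zero          rewrite proj₁ (step (suc n) (s≤s z≤n)) =
      solve 1 (λ a → a :+ :- a :+ :- con (+ 0) := con (+ 0)) refl (+ c (suc n) 0)
    coefficients (suc (suc n)) (suc k)       rewrite proj₂ (step (suc n) (s≤s z≤n)) k =
      solve 2 (λ a b → a :+ b :+ :- a :+ :- b := con (+ 0)) refl (+ c (suc n) (suc k)) (+ c (suc n) k)

    series : G ⊗ (𝟙 ⊖ X ⊖ X ⊗ Q) ≐ 𝟙 ⊖ X
    series = begin
      G ⊗ (𝟙 ⊖ X ⊖ X ⊗ Q)        ≈⟨ ⊗-distribˡ-⊖ G (𝟙 ⊖ X) (X ⊗ Q) ⟩
      G ⊗ (𝟙 ⊖ X) ⊖ G ⊗ (X ⊗ Q)  ≈⟨ ⊖-cong (⊗-𝟙⊖X G) (⊗-XQ G) ⟩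
      Δ G ⊖ q· x· G              ≈⟨ coefficients ⟩
      𝟙 ⊖ X                      ∎

  module CoupledRecurrence (c p : ℕ → ℕ → ℕ)
    (c₀₀ : c 0 0 ≡ 1) (c₀ₛ : ∀ k → c 0 (suc k) ≡ 0)
    (c₁₀ : c 1 0 ≡ 0) (c₁₁ : c 1 1 ≡ 1) (c₁ₛₛ : ∀ k → c 1 (suc (suc k)) ≡ 0)
    (p₁₀ : p 1 0 ≡ 1) (p₁ₛ : ∀ k → p 1 (suc k) ≡ 0)
    (c-rec-zero : ∀ n → 1 ≤ n → c (suc n) 0 ≡ 0)
    (c-rec-suc  : ∀ n → 1 ≤ n → ∀ k → c (suc n) (suc k) ≡ c n k + p n k)
    (p-rec-zero : ∀ n → 1 ≤ n → p (suc n) 0 ≡ c n 0)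
    (p-rec-suc  : ∀ n → 1 ≤ n → ∀ k → p (suc n) (suc k) ≡ c n (suc k) + p n k) where

    G : Series
    G n k = + c n k

    c-suc-zero : ∀ n → c (suc n) 0 ≡ 0
    c-suc-zero zero    = c₁₀
    c-suc-zero (suc n) = c-rec-zero (suc n) (s≤s z≤n)

    coefficients : ∇ (∇ G) ⊖ q· x· x· G ≐ 𝟙 ⊖ q· X
    coefficients zero    zero          rewrite c₀₀ = refl
    coefficients zero    (suc k)       rewrite c₀ₛ k = refl
    coefficients (suc zero) zero       rewrite c₁₀ = refl
    coefficients (suc zero) (suc zero) rewrite c₁₁ | c₀₀ = refl
    coefficients (suc zero) (suc (suc k)) rewrite c₁ₛₛ k | c₀ₛ k = refl
    coefficients (suc (suc zero)) zero rewrite c-suc-zero 1 = refl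
    coefficients (suc (suc zero)) (suc zero)
      rewrite c-rec-suc 1 (s≤s z≤n) 0 | c₁₀ | p₁₀ | c₀₀ = refl
    coefficients (suc (suc zero)) (suc (suc zero))
      rewrite c-rec-suc 1 (s≤s z≤n) 1 | c₁₁ | p₁ₛ 0 | c₀₀ | c₀ₛ 0 = refl
    coefficients (suc (suc zero)) (suc (suc (suc k)))
      rewrite c-rec-suc 1 (s≤s z≤n) (suc (suc k)) | c₁ₛₛ k | p₁ₛ (suc k) | c₀ₛ k | c₀ₛ (suc k) = refl
    coefficients (suc (suc (suc n))) zero rewrite c-suc-zero (suc (suc n)) = refl
    coefficients (suc (suc (suc n))) (suc zero)
      rewrite c-rec-suc (suc (suc n)) (s≤s z≤n) 0 | c-suc-zero (suc n) | p-rec-zero (suc n) (s≤s z≤n) | c-suc-zero n = refl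
    coefficients (suc (suc (suc n))) (suc (suc k))
      rewrite c-rec-suc (suc (suc n)) (s≤s z≤n) (suc k) | p-rec-suc (suc n) (s≤s z≤n) k | c-rec-suc (suc n) (s≤s z≤n) k =
      solve 3 (λ a b d → (a :+ d :+ (b :+ d)) :+ :- (a :+ d) :+ :- ((a :+ d) :+ :- a) :+ :- b := con (+ 0)) refl
        (+ c (suc n) k) (+ c (suc n) (suc k)) (+ p (suc n) k)

    series : G ⊗ ((𝟙 ⊖ X ⊗ Q) ⊗ (𝟙 ⊖ X ⊗ Q) ⊖ X ⊗ X ⊗ Q) ≐ 𝟙 ⊖ X ⊗ Q
    series = begin
      G ⊗ ((𝟙 ⊖ X ⊗ Q) ⊗ (𝟙 ⊖ X ⊗ Q) ⊖ X ⊗ X ⊗ Q)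
        ≈⟨ ⊗-distribˡ-⊖ G ((𝟙 ⊖ X ⊗ Q) ⊗ (𝟙 ⊖ X ⊗ Q)) (X ⊗ X ⊗ Q) ⟩
      G ⊗ ((𝟙 ⊖ X ⊗ Q) ⊗ (𝟙 ⊖ X ⊗ Q)) ⊖ G ⊗ (X ⊗ X ⊗ Q)
        ≈⟨ ⊖-cong (⊗-⊗-𝟙⊖XQ G (𝟙 ⊖ X ⊗ Q)) (⊗-XXQ G) ⟩
      ∇ (G ⊗ (𝟙 ⊖ X ⊗ Q)) ⊖ q· x· x· G
        ≈⟨ ⊖-cong (∇-cong (⊗-𝟙⊖XQ G)) (≐-refl {q· x· x· G}) ⟩
      ∇ (∇ G) ⊖ q· x· x· G
        ≈⟨ coefficients ⟩
      𝟙 ⊖ q· X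
        ≈˘⟨ ⊖-cong (≐-refl {𝟙}) (⊗-Q X) ⟩
      𝟙 ⊖ X ⊗ Q ∎

  module TriangularRecurrence (c : ℕ → ℕ → ℕ) (e : ℕ → ℕ)
    (c₀₀ : c 0 0 ≡ 1) (c₀ₛ : ∀ k → c 0 (suc k) ≡ 0)
    (c₁₀ : c 1 0 ≡ 0) (c₁₁ : c 1 1 ≡ 1) (c₁ₛₛ : ∀ k → c 1 (suc (suc k)) ≡ 0)
    (rec-0 : ∀ n → 1 ≤ n → c (suc n) 0 ≡ c n 0)
    (rec-1 : ∀ n → 1 ≤ n → c (suc n) 1 ≡ c n 1)
    (rec-2 : ∀ n → 1 ≤ n → c (suc n) 2 ≡ c n 2 + e (suc n))
    (rec-3+ : ∀ n → 1 ≤ n → ∀ k → c (suc n) (3 + k) ≡ c n (3 + k))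
    (e₁ : e 1 ≡ 0)
    (e-rec : ∀ n → 1 ≤ n → e (suc n) ≡ e n + c n 1) where

    triangle : ℕ → ℕ
    triangle zero    = 0
    triangle (suc n) = triangle n + suc n

    closed : ℕ → ℕ → ℕ
    closed zero    zero                = 1
    closed zero    (suc k)             = 0
    closed (suc n) zero                = 0
    closed (suc n) (suc zero)          = 1
    closed (suc n) (suc (suc zero))    = triangle n
    closed (suc n) (suc (suc (suc k))) = 0

    c-suc-one : ∀ n → c (suc n) 1 ≡ 1
    c-suc-one zero    = c₁₁
    c-suc-one (suc n) = trans (rec-1 (suc n) (s≤s z≤n)) (c-suc-one n)

    e-closed : ∀ n → e (suc n) ≡ n
    e-closed zero    = e₁
    e-closed (suc n) rewrite e-rec (suc n) (s≤s z≤n) | e-closed n | c-suc-one n = +-comm n 1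

    c-closed : ∀ n k → c n k ≡ closed n k
    c-closed zero             zero                = c₀₀
    c-closed zero             (suc k)             = c₀ₛ k
    c-closed (suc zero)       zero                = c₁₀
    c-closed (suc zero)       (suc zero)          = c₁₁
    c-closed (suc zero)       (suc (suc zero))    = c₁ₛₛ 0
    c-closed (suc zero)       (suc (suc (suc k))) = c₁ₛₛ (suc k)
    c-closed (suc (suc n))    zero                = trans (rec-0 (suc n) (s≤s z≤n)) (c-closed (suc n) 0)
    c-closed (suc (suc n))    (suc zero)          = trans (rec-1 (suc n) (s≤s z≤n)) (c-closed (suc n) 1)
    c-closed (suc (suc n))    (suc (suc zero))    =
      trans (rec-2 (suc n) (s≤s z≤n)) (cong₂ _+_ (c-closed (suc n) 2) (e-closed (suc n)))
    c-closed (suc (suc n))    (suc (suc (suc k))) =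
      trans (rec-3+ (suc n) (s≤s z≤n) k) (c-closed (suc n) (3 + k))

    G C : Series
    G n k = + c n k
    C n k = + closed n k

    coefficients : Δ (Δ (Δ C)) ≐ Δ (Δ (𝟙 ⊖ X)) ⊕ Δ (Δ (q· X)) ⊕ q· q· x· X
    coefficients zero zero = refl
    coefficients zero (suc zero) = refl
    coefficients zero (suc (suc zero)) = refl
    coefficients zero (suc (suc (suc k))) = refl
    coefficients (suc zero) zero = refl
    coefficients (suc zero) (suc zero) = refl
    coefficients (suc zero) (suc (suc zero)) = refl
    coefficients (suc zero) (suc (suc (suc k))) = refl
    coefficients (suc (suc zero)) zero = refl
    coefficients (suc (suc zero)) (suc zero) = refl
    coefficients (suc (suc zero)) (suc (suc zero)) = refl
    coefficients (suc (suc zero)) (suc (suc (suc k))) = refl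
    coefficients (suc (suc (suc zero))) zero = refl
    coefficients (suc (suc (suc zero))) (suc zero) = refl
    coefficients (suc (suc (suc zero))) (suc (suc zero)) = refl
    coefficients (suc (suc (suc zero))) (suc (suc (suc k))) = refl
    coefficients (suc (suc (suc (suc n)))) zero = refl
    coefficients (suc (suc (suc (suc n)))) (suc zero) = refl
    coefficients (suc (suc (suc (suc n)))) (suc (suc (suc k))) = refl
    coefficients (suc (suc (suc (suc n)))) (suc (suc zero)) =
      solve 2 (λ t n → let t₁ = t :+ (con (+ 1) :+ n)
                           t₂ = t₁ :+ (con (+ 2) :+ n)
                           t₃ = t₂ :+ (con (+ 3) :+ n)
                       in ((t₃ :+ :- t₂) :+ :- (t₂ :+ :- t₁)) :+ :- ((t₂ :+ :- t₁) :+ :- (t₁ :+ :- t)) := con (+ 0))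
        refl (+ triangle n) (+ n)

    series : G ⊗ ((𝟙 ⊖ X) ⊗ (𝟙 ⊖ X) ⊗ (𝟙 ⊖ X))
             ≐ (𝟙 ⊖ X) ⊗ (𝟙 ⊖ X) ⊗ (𝟙 ⊖ X) ⊕ X ⊗ Q ⊗ (𝟙 ⊖ X) ⊗ (𝟙 ⊖ X) ⊕ X ⊗ X ⊗ Q ⊗ Q
    series = begin
      G ⊗ ((𝟙 ⊖ X) ⊗ (𝟙 ⊖ X) ⊗ (𝟙 ⊖ X))
        ≈⟨ ⊗-congˡ ((𝟙 ⊖ X) ⊗ (𝟙 ⊖ X) ⊗ (𝟙 ⊖ X)) (λ n k → cong +_ (c-closed n k)) ⟩
      C ⊗ ((𝟙 ⊖ X) ⊗ (𝟙 ⊖ X) ⊗ (𝟙 ⊖ X))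
        ≈⟨ ⊗-⊗-𝟙⊖X C ((𝟙 ⊖ X) ⊗ (𝟙 ⊖ X)) ⟩
      Δ (C ⊗ ((𝟙 ⊖ X) ⊗ (𝟙 ⊖ X)))
        ≈⟨ Δ-cong (⊗-⊗-𝟙⊖X C (𝟙 ⊖ X)) ⟩
      Δ (Δ (C ⊗ (𝟙 ⊖ X)))
        ≈⟨ Δ-cong (Δ-cong (⊗-𝟙⊖X C)) ⟩
      Δ (Δ (Δ C))
        ≈⟨ coefficients ⟩
      Δ (Δ (𝟙 ⊖ X)) ⊕ Δ (Δ (q· X)) ⊕ q· q· x· X
        ≈˘⟨ ⊕-cong (⊕-cong cube linear) quadratic ⟩
      (𝟙 ⊖ X) ⊗ (𝟙 ⊖ X) ⊗ (𝟙 ⊖ X) ⊕ X ⊗ Q ⊗ (𝟙 ⊖ X) ⊗ (𝟙 ⊖ X) ⊕ X ⊗ X ⊗ Q ⊗ Q ∎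
      where
      cube : (𝟙 ⊖ X) ⊗ (𝟙 ⊖ X) ⊗ (𝟙 ⊖ X) ≐ Δ (Δ (𝟙 ⊖ X))
      cube = begin
        (𝟙 ⊖ X) ⊗ (𝟙 ⊖ X) ⊗ (𝟙 ⊖ X)  ≈⟨ ⊗-𝟙⊖X ((𝟙 ⊖ X) ⊗ (𝟙 ⊖ X)) ⟩
        Δ ((𝟙 ⊖ X) ⊗ (𝟙 ⊖ X))        ≈⟨ Δ-cong (⊗-𝟙⊖X (𝟙 ⊖ X)) ⟩
        Δ (Δ (𝟙 ⊖ X))                ∎
      linear : X ⊗ Q ⊗ (𝟙 ⊖ X) ⊗ (𝟙 ⊖ X) ≐ Δ (Δ (q· X))
      linear = begin
        X ⊗ Q ⊗ (𝟙 ⊖ X) ⊗ (𝟙 ⊖ X)  ≈⟨ ⊗-𝟙⊖X (X ⊗ Q ⊗ (𝟙 ⊖ X)) ⟩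
        Δ (X ⊗ Q ⊗ (𝟙 ⊖ X))        ≈⟨ Δ-cong (⊗-𝟙⊖X (X ⊗ Q)) ⟩
        Δ (Δ (X ⊗ Q))              ≈⟨ Δ-cong (Δ-cong (⊗-Q X)) ⟩
        Δ (Δ (q· X))               ∎
      quadratic : X ⊗ X ⊗ Q ⊗ Q ≐ q· q· x· X
      quadratic = begin
        X ⊗ X ⊗ Q ⊗ Q   ≈⟨ ⊗-Q (X ⊗ X ⊗ Q) ⟩
        q· (X ⊗ X ⊗ Q)  ≈⟨ q·-cong (⊗-Q (X ⊗ X)) ⟩
        q· q· (X ⊗ X)   ≈⟨ q·-cong (q·-cong (⊗-X X)) ⟩
        q· q· x· X      ∎

T⇒≡ : ∀ {b} → T b → b ≡ true
T⇒≡ {true} _ = refl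

≡⇒T : ∀ {b} → b ≡ true → T b
≡⇒T refl = tt

∧≡true : ∀ {a b} → a ≡ true → b ≡ true → a ∧ b ≡ true
∧≡true refl refl = refl

∧≡true⇒ˡ : ∀ a {b} → a ∧ b ≡ true → a ≡ true
∧≡true⇒ˡ true _ = refl

∧≡true⇒ʳ : ∀ a {b} → a ∧ b ≡ true → b ≡ true
∧≡true⇒ʳ true e = e

<ᵇ≡true⇒< : ∀ {x y} → (x <ᵇ y) ≡ true → x < y
<ᵇ≡true⇒< {x} {y} e = <ᵇ⇒< x y (≡⇒T e)

<ᵇ≡false⇒≥ : ∀ {x y} → (x <ᵇ y) ≡ false → y ≤ x
<ᵇ≡false⇒≥ {x} {y} e = ≮⇒≥ (λ x<y → subst T e (<⇒<ᵇ x<y))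

<⇒<ᵇ≡true : ∀ {x y} → x < y → (x <ᵇ y) ≡ true
<⇒<ᵇ≡true x<y = T⇒≡ (<⇒<ᵇ x<y)

≥⇒<ᵇ≡false : ∀ {x y} → y ≤ x → (x <ᵇ y) ≡ false
≥⇒<ᵇ≡false {x} {y} y≤x with x <ᵇ y in e
... | false = refl
... | true  = ⊥-elim (<⇒≱ (<ᵇ≡true⇒< e) y≤x)

≡ᵇ≡true⇒≡ : ∀ {a b} → (a ≡ᵇ b) ≡ true → a ≡ b
≡ᵇ≡true⇒≡ {a} {b} e = ≡ᵇ⇒≡ a b (≡⇒T e)

≢⇒≡ᵇ≡false : ∀ {a b} → a ≢ b → (a ≡ᵇ b) ≡ false
≢⇒≡ᵇ≡false {a} {b} a≢b with a ≡ᵇ b in e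
... | false = refl
... | true  = ⊥-elim (a≢b (≡ᵇ≡true⇒≡ e))

≡ᵇ-refl : ∀ a → (a ≡ᵇ a) ≡ true
≡ᵇ-refl a = T⇒≡ (≡⇒≡ᵇ a a refl)

-- Sublists

infix 4 _⊑_
data _⊑_ : List ℕ → List ℕ → Set where
  done : ∀ {ys} → [] ⊑ ys
  skip : ∀ {xs y ys} → xs ⊑ ys → xs ⊑ (y ∷ ys)
  keep : ∀ {x xs ys} → xs ⊑ ys → (x ∷ xs) ⊑ (x ∷ ys)

⊑-refl : ∀ xs → xs ⊑ xs
⊑-refl []       = done
⊑-refl (x ∷ xs) = keep (⊑-refl xs)

⊑-trans : ∀ {a b c} → a ⊑ b → b ⊑ c → a ⊑ c
⊑-trans done     q        = done
⊑-trans p        (skip q) = skip (⊑-trans p q)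
⊑-trans (skip p) (keep q) = skip (⊑-trans p q)
⊑-trans (keep p) (keep q) = keep (⊑-trans p q)

⊑-[] : ∀ {s} → s ⊑ [] → s ≡ []
⊑-[] done = refl

⊑-singleton : ∀ {s x} → s ⊑ [ x ] → (s ≡ []) ⊎ (s ≡ [ x ])
⊑-singleton done        = inj₁ refl
⊑-singleton (skip done) = inj₁ refl
⊑-singleton (keep done) = inj₂ refl

⊑-∈ : ∀ {s xs x} → s ⊑ xs → x ∈ s → x ∈ xs
⊑-∈ (skip p) x∈s         = there (⊑-∈ p x∈s)
⊑-∈ (keep p) (here refl) = here refl
⊑-∈ (keep p) (there x∈s) = there (⊑-∈ p x∈s)

⊑-pair⇒∈ : ∀ {x y xs} → (x ∷ y ∷ []) ⊑ xs → (x ∈ xs) × (y ∈ xs)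
⊑-pair⇒∈ p = ⊑-∈ p (here refl) , ⊑-∈ p (there (here refl))

∈⇒⊑ : ∀ {x xs} → x ∈ xs → [ x ] ⊑ xs
∈⇒⊑ (here refl) = keep done
∈⇒⊑ (there x∈xs) = skip (∈⇒⊑ x∈xs)

⊑-pair-either : ∀ {x y xs} → x ∈ xs → y ∈ xs → x ≢ y → ((x ∷ y ∷ []) ⊑ xs) ⊎ ((y ∷ x ∷ []) ⊑ xs)
⊑-pair-either (here refl) (here refl) x≢y = ⊥-elim (x≢y refl)
⊑-pair-either (here refl) (there y∈) _   = inj₁ (keep (∈⇒⊑ y∈))
⊑-pair-either (there x∈) (here refl) _   = inj₂ (keep (∈⇒⊑ x∈))
⊑-pair-either (there x∈) (there y∈) x≢y with ⊑-pair-either x∈ y∈ x≢y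
... | inj₁ p = inj₁ (skip p)
... | inj₂ p = inj₂ (skip p)

All-⊑ : ∀ {P : ℕ → Set} {s t} → s ⊑ t → All P t → All P s
All-⊑ done     _        = []
All-⊑ (skip p) (_ ∷ ps) = All-⊑ p ps
All-⊑ (keep p) (q ∷ ps) = q ∷ All-⊑ p ps

⊑-++ : ∀ {s t xs ys} → s ⊑ xs → t ⊑ ys → s ++ t ⊑ xs ++ ys
⊑-++ {xs = []}     done q = q
⊑-++ {xs = x ∷ xs} done q = skip (⊑-++ {xs = xs} done q)
⊑-++ (skip p) q = skip (⊑-++ p q)
⊑-++ (keep p) q = keep (⊑-++ p q)

⊑-++ˡ : ∀ {t ys} xs → t ⊑ ys → t ⊑ xs ++ ys
⊑-++ˡ []       q = q
⊑-++ˡ (x ∷ xs) q = skip (⊑-++ˡ xs q)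

⊑-++ʳ : ∀ {s xs} ys → s ⊑ xs → s ⊑ xs ++ ys
⊑-++ʳ ys done     = done
⊑-++ʳ ys (skip p) = skip (⊑-++ʳ ys p)
⊑-++ʳ ys (keep p) = keep (⊑-++ʳ ys p)

⊑-∷ʳ : ∀ γ (x : ℕ) → γ ⊑ γ ++ [ x ]
⊑-∷ʳ γ x = ⊑-++ʳ [ x ] (⊑-refl γ)

⊑-insert : ∀ {s} xs v {ys} → s ⊑ xs ++ ys → s ⊑ xs ++ v ∷ ys
⊑-insert []       v p        = skip p
⊑-insert (x ∷ xs) v done     = done
⊑-insert (x ∷ xs) v (skip p) = skip (⊑-insert xs v p)
⊑-insert (x ∷ xs) v (keep p) = keep (⊑-insert xs v p)

⊑-map⁺ : ∀ f {s xs} → s ⊑ xs → map f s ⊑ map f xs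
⊑-map⁺ f done     = done
⊑-map⁺ f (skip p) = skip (⊑-map⁺ f p)
⊑-map⁺ f (keep p) = keep (⊑-map⁺ f p)

⊑-map⁻ : ∀ f {s xs} → s ⊑ map f xs → Σ (List ℕ) λ s′ → (s ≡ map f s′) × (s′ ⊑ xs)
⊑-map⁻ f {xs = []}     done = [] , refl , done
⊑-map⁻ f {xs = x ∷ xs} done = [] , refl , done
⊑-map⁻ f {xs = x ∷ xs} (skip p) with s′ , refl , q ← ⊑-map⁻ f p = s′ , refl , skip q
⊑-map⁻ f {xs = x ∷ xs} (keep p) with s′ , refl , q ← ⊑-map⁻ f p = x ∷ s′ , refl , keep q

⊑-split : ∀ {s} xs v ys → s ⊑ xs ++ v ∷ ys →
  (s ⊑ xs ++ ys) ⊎ (Σ (List ℕ) λ s₁ → Σ (List ℕ) λ s₂ → (s ≡ s₁ ++ v ∷ s₂) × (s₁ ⊑ xs) × (s₂ ⊑ ys))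
⊑-split []       v ys done     = inj₁ done
⊑-split []       v ys (skip p) = inj₁ p
⊑-split []       v ys (keep p) = inj₂ ([] , _ , refl , done , p)
⊑-split (x ∷ xs) v ys done     = inj₁ done
⊑-split (x ∷ xs) v ys (skip p) with ⊑-split xs v ys p
... | inj₁ q                         = inj₁ (skip q)
... | inj₂ (s₁ , s₂ , e , q₁ , q₂)    = inj₂ (s₁ , s₂ , e , skip q₁ , q₂)
⊑-split (x ∷ xs) v ys (keep p) with ⊑-split xs v ys p
... | inj₁ q                         = inj₁ (keep q)
... | inj₂ (s₁ , s₂ , refl , q₁ , q₂) = inj₂ (x ∷ s₁ , s₂ , refl , keep q₁ , q₂)

data TripleSplit (xs : List ℕ) (v : ℕ) (ys : List ℕ) (x y z : ℕ) : Set where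
  avoiding : (x ∷ y ∷ z ∷ []) ⊑ xs ++ ys → TripleSplit xs v ys x y z
  first    : x ≡ v → (y ∷ z ∷ []) ⊑ ys → TripleSplit xs v ys x y z
  second   : y ≡ v → x ∈ xs → z ∈ ys → TripleSplit xs v ys x y z
  third    : z ≡ v → (x ∷ y ∷ []) ⊑ xs → TripleSplit xs v ys x y z

tripleSplit : ∀ xs v ys {x y z} → (x ∷ y ∷ z ∷ []) ⊑ xs ++ v ∷ ys → TripleSplit xs v ys x y z
tripleSplit xs v ys p with ⊑-split xs v ys p
... | inj₁ q                                   = avoiding q
... | inj₂ ([] , _ , refl , _ , q₂)             = first refl q₂
... | inj₂ (_ ∷ [] , _ , refl , q₁ , q₂)        = second refl (⊑-∈ q₁ (here refl)) (⊑-∈ q₂ (here refl))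
... | inj₂ (_ ∷ _ ∷ [] , [] , refl , q₁ , _)    = third refl q₁
... | inj₂ (_ ∷ _ ∷ [] , _ ∷ _ , () , _ , _)
... | inj₂ (_ ∷ _ ∷ _ ∷ [] , _ , () , _ , _)
... | inj₂ (_ ∷ _ ∷ _ ∷ _ ∷ _ , _ , () , _ , _)

data PairSplit (xs : List ℕ) (v : ℕ) (ys : List ℕ) (x y : ℕ) : Set where
  avoiding : (x ∷ y ∷ []) ⊑ xs ++ ys → PairSplit xs v ys x y
  first    : x ≡ v → y ∈ ys → PairSplit xs v ys x y
  second   : y ≡ v → x ∈ xs → PairSplit xs v ys x y

pairSplit : ∀ xs v ys {x y} → (x ∷ y ∷ []) ⊑ xs ++ v ∷ ys → PairSplit xs v ys x y
pairSplit xs v ys p with ⊑-split xs v ys p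
... | inj₁ q                            = avoiding q
... | inj₂ ([] , _ , refl , _ , q₂)      = first refl (⊑-∈ q₂ (here refl))
... | inj₂ (_ ∷ [] , [] , refl , q₁ , _) = second refl (⊑-∈ q₁ (here refl))
... | inj₂ (_ ∷ [] , _ ∷ _ , () , _ , _)
... | inj₂ (_ ∷ _ ∷ [] , _ , () , _ , _)
... | inj₂ (_ ∷ _ ∷ _ ∷ _ , _ , () , _ , _)

-- Subsequences

∈-subseqs⁺ : ∀ {s σ} → s ⊑ σ → s ∈ subseqs σ
∈-subseqs⁺ {σ = []}    done     = here refl
∈-subseqs⁺ {σ = a ∷ σ} done     = ∈-++⁺ʳ (map (a ∷_) (subseqs σ)) (∈-subseqs⁺ {σ = σ} done)
∈-subseqs⁺ {σ = a ∷ σ} (skip p) = ∈-++⁺ʳ (map (a ∷_) (subseqs σ)) (∈-subseqs⁺ p)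
∈-subseqs⁺ {σ = a ∷ σ} (keep p) = ∈-++⁺ˡ (∈-map⁺ (a ∷_) (∈-subseqs⁺ p))

∈-subseqs⁻ : ∀ {s} σ → s ∈ subseqs σ → s ⊑ σ
∈-subseqs⁻ []      (here refl) = done
∈-subseqs⁻ (a ∷ σ) s∈ with ∈-++⁻ (map (a ∷_) (subseqs σ)) s∈
... | inj₂ s∈′ = skip (∈-subseqs⁻ σ s∈′)
... | inj₁ s∈′ with _ , s′∈ , refl ← ∈-map⁻ (a ∷_) s∈′ = keep (∈-subseqs⁻ σ s′∈)

any⇒∈ : ∀ {f : List ℕ → Bool} xs → any f xs ≡ true → Σ (List ℕ) λ x → (x ∈ xs) × (f x ≡ true)
any⇒∈ {f} (x ∷ xs) e with f x in fx
... | true  = x , here refl , fx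
... | false with y , y∈ , fy ← any⇒∈ xs e = y , there y∈ , fy

∈⇒any : ∀ {f : List ℕ → Bool} {x} xs → x ∈ xs → f x ≡ true → any f xs ≡ true
∈⇒any {f} (y ∷ xs) (here refl) fx rewrite fx = refl
∈⇒any {f} (y ∷ xs) (there x∈) fx with f y
... | true  = refl
... | false = ∈⇒any xs x∈ fx

-- Patterns of length three

orderIso⇒length≡ : ∀ τ s → orderIso τ s ≡ true → length τ ≡ length s
orderIso⇒length≡ []      []      _ = refl
orderIso⇒length≡ (a ∷ τ) (b ∷ s) e = cong suc (orderIso⇒length≡ τ s (∧≡true⇒ʳ _ e))

matches : List ℕ → ℕ → ℕ → ℕ → Bool
matches τ x y z = orderIso τ (x ∷ y ∷ z ∷ [])

xnor≡true⇒≡ : ∀ p q → not (p xor q) ≡ true → q ≡ p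
xnor≡true⇒≡ true  true  _ = refl
xnor≡true⇒≡ false false _ = refl

conjuncts : ∀ p q r {s} → (p ∧ (q ∧ true)) ∧ ((r ∧ true) ∧ s) ≡ true → p ≡ true × q ≡ true × r ≡ true
conjuncts true true true _ = refl , refl , refl

matches⁻ : ∀ a b c x y z → matches (a ∷ b ∷ c ∷ []) x y z ≡ true →
           ((x <ᵇ y) ≡ (a <ᵇ b)) × ((x <ᵇ z) ≡ (a <ᵇ c)) × ((y <ᵇ z) ≡ (b <ᵇ c))
matches⁻ a b c x y z m
  with xy , xz , yz ← conjuncts (not ((a <ᵇ b) xor (x <ᵇ y))) (not ((a <ᵇ c) xor (x <ᵇ z)))
                                (not ((b <ᵇ c) xor (y <ᵇ z))) m
  = xnor≡true⇒≡ _ _ xy , xnor≡true⇒≡ _ _ xz , xnor≡true⇒≡ _ _ yz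

p123 p132 p213 p231 p321 : List ℕ
p123 = 1 ∷ 2 ∷ 3 ∷ []
p132 = 1 ∷ 3 ∷ 2 ∷ []
p213 = 2 ∷ 1 ∷ 3 ∷ []
p231 = 2 ∷ 3 ∷ 1 ∷ []
p321 = 3 ∷ 2 ∷ 1 ∷ []

matches-312⁻ : ∀ x y z → matches p312 x y z ≡ true → (y ≤ x) × (z ≤ x) × (y < z)
matches-312⁻ x y z m with xy , xz , yz ← matches⁻ 3 1 2 x y z m = <ᵇ≡false⇒≥ xy , <ᵇ≡false⇒≥ xz , <ᵇ≡true⇒< yz

matches-312⁺ : ∀ x y z → y ≤ x → z ≤ x → y < z → matches p312 x y z ≡ true
matches-312⁺ x y z y≤x z≤x y<z rewrite ≥⇒<ᵇ≡false y≤x | ≥⇒<ᵇ≡false z≤x | <⇒<ᵇ≡true y<z = refl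

matches-123⁻ : ∀ x y z → matches p123 x y z ≡ true → (x < y) × (x < z) × (y < z)
matches-123⁻ x y z m with xy , xz , yz ← matches⁻ 1 2 3 x y z m = <ᵇ≡true⇒< xy , <ᵇ≡true⇒< xz , <ᵇ≡true⇒< yz

matches-123⁺ : ∀ x y z → x < y → x < z → y < z → matches p123 x y z ≡ true
matches-123⁺ x y z x<y x<z y<z rewrite <⇒<ᵇ≡true x<y | <⇒<ᵇ≡true x<z | <⇒<ᵇ≡true y<z = refl

matches-132⁻ : ∀ x y z → matches p132 x y z ≡ true → (x < y) × (x < z) × (z ≤ y)
matches-132⁻ x y z m with xy , xz , yz ← matches⁻ 1 3 2 x y z m = <ᵇ≡true⇒< xy , <ᵇ≡true⇒< xz , <ᵇ≡false⇒≥ yz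

matches-132⁺ : ∀ x y z → x < y → x < z → z ≤ y → matches p132 x y z ≡ true
matches-132⁺ x y z x<y x<z z≤y rewrite <⇒<ᵇ≡true x<y | <⇒<ᵇ≡true x<z | ≥⇒<ᵇ≡false z≤y = refl

matches-213⁻ : ∀ x y z → matches p213 x y z ≡ true → (y ≤ x) × (x < z) × (y < z)
matches-213⁻ x y z m with xy , xz , yz ← matches⁻ 2 1 3 x y z m = <ᵇ≡false⇒≥ xy , <ᵇ≡true⇒< xz , <ᵇ≡true⇒< yz

matches-213⁺ : ∀ x y z → y ≤ x → x < z → y < z → matches p213 x y z ≡ true
matches-213⁺ x y z y≤x x<z y<z rewrite ≥⇒<ᵇ≡false y≤x | <⇒<ᵇ≡true x<z | <⇒<ᵇ≡true y<z = refl

matches-231⁻ : ∀ x y z → matches p231 x y z ≡ true → (x < y) × (z ≤ x) × (z ≤ y)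
matches-231⁻ x y z m with xy , xz , yz ← matches⁻ 2 3 1 x y z m = <ᵇ≡true⇒< xy , <ᵇ≡false⇒≥ xz , <ᵇ≡false⇒≥ yz

matches-231⁺ : ∀ x y z → x < y → z ≤ x → z ≤ y → matches p231 x y z ≡ true
matches-231⁺ x y z x<y z≤x z≤y rewrite <⇒<ᵇ≡true x<y | ≥⇒<ᵇ≡false z≤x | ≥⇒<ᵇ≡false z≤y = refl

matches-321⁻ : ∀ x y z → matches p321 x y z ≡ true → (y ≤ x) × (z ≤ x) × (z ≤ y)
matches-321⁻ x y z m with xy , xz , yz ← matches⁻ 3 2 1 x y z m = <ᵇ≡false⇒≥ xy , <ᵇ≡false⇒≥ xz , <ᵇ≡false⇒≥ yz

matches-321⁺ : ∀ x y z → y ≤ x → z ≤ x → z ≤ y → matches p321 x y z ≡ true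
matches-321⁺ x y z y≤x z≤x z≤y rewrite ≥⇒<ᵇ≡false y≤x | ≥⇒<ᵇ≡false z≤x | ≥⇒<ᵇ≡false z≤y = refl

contains⁺ : ∀ {σ} τ {x y z} → (x ∷ y ∷ z ∷ []) ⊑ σ → matches τ x y z ≡ true → contains σ τ ≡ true
contains⁺ {σ} τ p m = ∈⇒any (subseqs σ) (∈-subseqs⁺ p) m

avoids⁻ : ∀ τ {x y z σ} → (x ∷ y ∷ z ∷ []) ⊑ σ → avoids σ τ ≡ true → matches τ x y z ≡ true → ⊥
avoids⁻ τ {σ = σ} p a m rewrite contains⁺ {σ} τ p m with () ← a

avoids⁺ : ∀ {σ} t₁ t₂ t₃ →
  (∀ x y z → (x ∷ y ∷ z ∷ []) ⊑ σ → matches (t₁ ∷ t₂ ∷ t₃ ∷ []) x y z ≡ true → ⊥) →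
  avoids σ (t₁ ∷ t₂ ∷ t₃ ∷ []) ≡ true
avoids⁺ {σ} t₁ t₂ t₃ noMatch with contains σ (t₁ ∷ t₂ ∷ t₃ ∷ []) in c
... | false = refl
... | true with any⇒∈ (subseqs σ) c
...   | s , s∈ , m with orderIso⇒length≡ (t₁ ∷ t₂ ∷ t₃ ∷ []) s m
avoids⁺ {σ} t₁ t₂ t₃ noMatch | true | (x ∷ y ∷ z ∷ []) , s∈ , m | refl = ⊥-elim (noMatch x y z (∈-subseqs⁻ σ s∈) m)

avoids-⊑ : ∀ {ρ σ} t₁ t₂ t₃ → ρ ⊑ σ → avoids σ (t₁ ∷ t₂ ∷ t₃ ∷ []) ≡ true → avoids ρ (t₁ ∷ t₂ ∷ t₃ ∷ []) ≡ true
avoids-⊑ {ρ} {σ} t₁ t₂ t₃ ρ⊑σ a = avoids⁺ {ρ} t₁ t₂ t₃ λ x y z p m → avoids⁻ (t₁ ∷ t₂ ∷ t₃ ∷ []) (⊑-trans p ρ⊑σ) a m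

avoids-map-suc⁺ : ∀ {ρ} t₁ t₂ t₃ → avoids ρ (t₁ ∷ t₂ ∷ t₃ ∷ []) ≡ true → avoids (map suc ρ) (t₁ ∷ t₂ ∷ t₃ ∷ []) ≡ true
avoids-map-suc⁺ {ρ} t₁ t₂ t₃ a = avoids⁺ {map suc ρ} t₁ t₂ t₃ noMatch
  where
  noMatch : ∀ x y z → (x ∷ y ∷ z ∷ []) ⊑ map suc ρ → matches (t₁ ∷ t₂ ∷ t₃ ∷ []) x y z ≡ true → ⊥
  noMatch x y z p m with _ ∷ _ ∷ _ ∷ [] , refl , q ← ⊑-map⁻ suc p = avoids⁻ (t₁ ∷ t₂ ∷ t₃ ∷ []) q a m

avoids-map-suc⁻ : ∀ {ρ} t₁ t₂ t₃ → avoids (map suc ρ) (t₁ ∷ t₂ ∷ t₃ ∷ []) ≡ true → avoids ρ (t₁ ∷ t₂ ∷ t₃ ∷ []) ≡ true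
avoids-map-suc⁻ {ρ} t₁ t₂ t₃ a =
  avoids⁺ {ρ} t₁ t₂ t₃ λ x y z p m → avoids⁻ (t₁ ∷ t₂ ∷ t₃ ∷ []) (⊑-map⁺ suc p) a m

avoids-insert : ∀ xs v ys t₁ t₂ t₃ → avoids (xs ++ ys) (t₁ ∷ t₂ ∷ t₃ ∷ []) ≡ true →
  (∀ y z → (y ∷ z ∷ []) ⊑ ys → matches (t₁ ∷ t₂ ∷ t₃ ∷ []) v y z ≡ true → ⊥) →
  (∀ x z → x ∈ xs → z ∈ ys → matches (t₁ ∷ t₂ ∷ t₃ ∷ []) x v z ≡ true → ⊥) →
  (∀ x y → (x ∷ y ∷ []) ⊑ xs → matches (t₁ ∷ t₂ ∷ t₃ ∷ []) x y v ≡ true → ⊥) →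
  avoids (xs ++ v ∷ ys) (t₁ ∷ t₂ ∷ t₃ ∷ []) ≡ true
avoids-insert xs v ys t₁ t₂ t₃ a noFirst noSecond noThird = avoids⁺ {xs ++ v ∷ ys} t₁ t₂ t₃ noMatch
  where
  noMatch : ∀ x y z → (x ∷ y ∷ z ∷ []) ⊑ xs ++ v ∷ ys → matches (t₁ ∷ t₂ ∷ t₃ ∷ []) x y z ≡ true → ⊥
  noMatch x y z p m with tripleSplit xs v ys p
  ... | avoiding q       = avoids⁻ (t₁ ∷ t₂ ∷ t₃ ∷ []) q a m
  ... | first refl q     = noFirst y z q m
  ... | second refl x∈ z∈ = noSecond x z x∈ z∈ m
  ... | third refl q     = noThird x y q m

-- Increasing subsequences

record Increasing (s : List ℕ) : Set where
  constructor increasing✓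
  field increasing≡true : increasing s ≡ true
open Increasing public

inc-tail : ∀ {a s} → Increasing (a ∷ s) → Increasing s
inc-tail {a} {[]}    _                 = increasing✓ refl
inc-tail {a} {b ∷ s} (increasing✓ inc) = increasing✓ (∧≡true⇒ʳ (a <ᵇ b) inc)

inc-head : ∀ {a b s} → Increasing (a ∷ b ∷ s) → a < b
inc-head {a} {b} (increasing✓ inc) = <ᵇ≡true⇒< (∧≡true⇒ˡ (a <ᵇ b) inc)

inc-all : ∀ {a s} → Increasing (a ∷ s) → All (a <_) s
inc-all {a} {[]}    _   = []
inc-all {a} {b ∷ s} inc = inc-head inc ∷ All.map (<-trans (inc-head inc)) (inc-all (inc-tail inc))

inc-cons : ∀ {a s} → All (a <_) s → Increasing s → Increasing (a ∷ s)
inc-cons []          _                 = increasing✓ refl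
inc-cons (a<b ∷ _) (increasing✓ inc) = increasing✓ (∧≡true (<⇒<ᵇ≡true a<b) inc)

inc-++ˡ : ∀ s {t} → Increasing (s ++ t) → Increasing s
inc-++ˡ []          _   = increasing✓ refl
inc-++ˡ (a ∷ [])    _   = increasing✓ refl
inc-++ˡ (a ∷ b ∷ s) inc =
  increasing✓ (∧≡true (<⇒<ᵇ≡true (inc-head inc)) (increasing≡true (inc-++ˡ (b ∷ s) (inc-tail inc))))

inc-++-< : ∀ s {t x y} → Increasing (s ++ t) → x ∈ s → y ∈ t → x < y
inc-++-< (a ∷ s) inc (here refl) y∈ = All.lookup (inc-all inc) (∈-++⁺ʳ s y∈)
inc-++-< (a ∷ s) inc (there x∈) y∈  = inc-++-< s (inc-tail inc) x∈ y∈

inc-∷ʳ : ∀ s {v} → Increasing s → All (_< v) s → Increasing (s ++ [ v ])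
inc-∷ʳ []          _   _          = increasing✓ refl
inc-∷ʳ (a ∷ [])    _   (a<v ∷ []) = increasing✓ (∧≡true (<⇒<ᵇ≡true a<v) refl)
inc-∷ʳ (a ∷ b ∷ s) inc (_ ∷ s<v)  =
  increasing✓ (∧≡true (<⇒<ᵇ≡true (inc-head inc)) (increasing≡true (inc-∷ʳ (b ∷ s) (inc-tail inc) s<v)))

increasing-map-suc : ∀ s → increasing (map suc s) ≡ increasing s
increasing-map-suc []          = refl
increasing-map-suc (a ∷ [])    = refl
increasing-map-suc (a ∷ b ∷ s) rewrite increasing-map-suc (b ∷ s) = refl

-- Longest increasing subsequences

foldr-⊔-upperBound : ∀ {x} xs → x ∈ xs → x ≤ foldr _⊔_ 0 xs
foldr-⊔-upperBound (y ∷ xs) (here refl) = m≤m⊔n y _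
foldr-⊔-upperBound (y ∷ xs) (there x∈)  = ≤-trans (foldr-⊔-upperBound xs x∈) (m≤n⊔m y _)

foldr-⊔-attained : ∀ xs → (foldr _⊔_ 0 xs ≡ 0) ⊎ (foldr _⊔_ 0 xs ∈ xs)
foldr-⊔-attained []       = inj₁ refl
foldr-⊔-attained (y ∷ xs) with ⊔-sel y (foldr _⊔_ 0 xs)
... | inj₁ e rewrite e = inj₂ (here refl)
... | inj₂ e rewrite e with foldr-⊔-attained xs
...   | inj₁ max≡0 = inj₁ max≡0
...   | inj₂ max∈  = inj₂ (there max∈)

length≤lis : ∀ {σ s} → s ⊑ σ → Increasing s → length s ≤ lis σ
length≤lis {σ} s⊑σ inc = foldr-⊔-upperBound _
  (∈-map⁺ length (∈-filter⁺ (T? ∘ increasing) {xs = subseqs σ} (∈-subseqs⁺ s⊑σ) (≡⇒T (increasing≡true inc))))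

lis-witness : ∀ σ → Σ (List ℕ) λ s → (s ⊑ σ) × Increasing s × (length s ≡ lis σ)
lis-witness σ with foldr-⊔-attained (map length (filterᵇ increasing (subseqs σ)))
... | inj₁ lis≡0 = [] , done , increasing✓ refl , sym lis≡0
... | inj₂ lis∈ with s , s∈ , lis≡length ← ∈-map⁻ length lis∈
                with s∈′ , inc ← ∈-filter⁻ (T? ∘ increasing) {xs = subseqs σ} s∈
  = s , ∈-subseqs⁻ σ s∈′ , increasing✓ (T⇒≡ inc) , sym lis≡length

lis≤ : ∀ {σ L} → (∀ s → s ⊑ σ → Increasing s → length s ≤ L) → lis σ ≤ L
lis≤ {σ} bound with s , s⊑σ , inc , length≡lis ← lis-witness σ = subst (_≤ _) length≡lis (bound s s⊑σ inc)

lis≡ : ∀ {σ s L} → s ⊑ σ → Increasing s → length s ≡ L → (∀ s′ → s′ ⊑ σ → Increasing s′ → length s′ ≤ L) → lis σ ≡ L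
lis≡ s⊑σ inc refl bound = ≤-antisym (lis≤ bound) (length≤lis s⊑σ inc)

avoids123⇒lis≤2 : ∀ {σ} → avoids σ p123 ≡ true → lis σ ≤ 2
avoids123⇒lis≤2 {σ} av = lis≤ bound
  where
  bound : ∀ s′ → s′ ⊑ σ → Increasing s′ → length s′ ≤ 2
  bound [] q i = z≤n
  bound (a ∷ []) q i = s≤s z≤n
  bound (a ∷ b ∷ []) q i = s≤s (s≤s z≤n)
  bound (a ∷ b ∷ c ∷ r) q i = ⊥-elim (avoids⁻ p123 (⊑-trans (keep (keep (keep done))) q) av
     (matches-123⁺ a b c (inc-head i) (<-trans (inc-head i) (inc-head (inc-tail i))) (inc-head (inc-tail i))))

lis≥2 : ∀ {σ a b} → (a ∷ b ∷ []) ⊑ σ → a < b → 2 ≤ lis σ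
lis≥2 {σ} {a} {b} q lt = length≤lis q (inc-cons (lt ∷ []) (increasing✓ refl))

-- Permutations

∉⇒any≡ᵇ≡false : ∀ a as → a ∉ as → any (a ≡ᵇ_) as ≡ false
∉⇒any≡ᵇ≡false a []       _   = refl
∉⇒any≡ᵇ≡false a (b ∷ as) a∉ rewrite ≢⇒≡ᵇ≡false {a} {b} (a∉ ∘ here) = ∉⇒any≡ᵇ≡false a as (a∉ ∘ there)

any≡ᵇ≡false⇒∉ : ∀ a as → any (a ≡ᵇ_) as ≡ false → a ∉ as
any≡ᵇ≡false⇒∉ a (b ∷ as) e (here refl) rewrite ≡ᵇ-refl a with () ← e
any≡ᵇ≡false⇒∉ a (b ∷ as) e (there a∈) with a ≡ᵇ b
... | false = any≡ᵇ≡false⇒∉ a as e a∈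

distinct⇒Unique : ∀ σ → distinct σ ≡ true → Unique σ
distinct⇒Unique []      _ = []
distinct⇒Unique (a ∷ σ) d with any (a ≡ᵇ_) σ in a∉
... | false = ¬Any⇒All¬ σ (any≡ᵇ≡false⇒∉ a σ a∉) ∷ distinct⇒Unique σ d

Unique⇒distinct : ∀ σ → Unique σ → distinct σ ≡ true
Unique⇒distinct []      _            = refl
Unique⇒distinct (a ∷ σ) u@(_ ∷ u′)
  rewrite ∉⇒any≡ᵇ≡false a σ (UP.Unique[x∷xs]⇒x∉xs u) = Unique⇒distinct σ u′

words-∈⁻ : ∀ l m {σ} → σ ∈ words l m → (length σ ≡ l) × All (_< m) σ
words-∈⁻ zero    m (here refl) = refl , []
words-∈⁻ (suc l) m σ∈
  with w , w∈ , σ∈′ ← find (∈-concatMap⁻ (λ w → map (_∷ w) (upTo m)) {xs = words l m} σ∈)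
  with a , a∈ , refl ← ∈-map⁻ (_∷ w) σ∈′
  with length≡ , w<m ← words-∈⁻ l m w∈
  = cong suc length≡ , ∈-upTo⁻ a∈ ∷ w<m

words-∈⁺ : ∀ l m {σ} → length σ ≡ l → All (_< m) σ → σ ∈ words l m
words-∈⁺ zero    m {[]}    refl []          = here refl
words-∈⁺ (suc l) m {a ∷ σ} length≡ (a<m ∷ σ<m) =
  ∈-concatMap⁺ (λ w → map (_∷ w) (upTo m)) {xs = words l m}
    (lose (words-∈⁺ l m (suc-injective length≡) σ<m) (∈-map⁺ (_∷ σ) (∈-upTo⁺ a<m)))

Unique-concatMap : ∀ {f : List ℕ → List (List ℕ)} {xs} → Unique xs → (∀ x → Unique (f x)) →
  (∀ {x y z} → z ∈ f x → z ∈ f y → x ≡ y) → Unique (concatMap f xs)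
Unique-concatMap {f} {[]}     _        _       _         = []
Unique-concatMap {f} {x ∷ xs} (x∉ ∷ u) unique-f disjoint =
  UP.++⁺ (unique-f x) (Unique-concatMap u unique-f disjoint) separated
  where
  separated : Disjoint (f x) (concatMap f xs)
  separated (z∈fx , z∈rest) with y , y∈ , z∈fy ← find (∈-concatMap⁻ f {xs = xs} z∈rest)
                            with refl ← disjoint z∈fx z∈fy
    = All¬⇒¬Any x∉ y∈

words-Unique : ∀ l m → Unique (words l m)
words-Unique zero    m = [] ∷ []
words-Unique (suc l) m =
  Unique-concatMap (words-Unique l m) (λ w → UP.map⁺ (λ { refl → refl }) (UP.upTo⁺ m)) sameTail
  where
  sameTail : ∀ {x y z} → z ∈ map (_∷ x) (upTo m) → z ∈ map (_∷ y) (upTo m) → x ≡ y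
  sameTail z∈ z∈′ with _ , _ , refl ← ∈-map⁻ _ z∈ with _ , _ , refl ← ∈-map⁻ _ z∈′ = refl

IsPerm : ℕ → List ℕ → Set
IsPerm n σ = (length σ ≡ n) × Unique σ × All (_< n) σ

perms-∈⁻ : ∀ n {σ} → σ ∈ perms n → IsPerm n σ
perms-∈⁻ n {σ} σ∈ with σ∈′ , d ← ∈-filter⁻ (T? ∘ distinct) {xs = words n n} σ∈
                  with length≡ , σ<n ← words-∈⁻ n n σ∈′
  = length≡ , distinct⇒Unique σ (T⇒≡ d) , σ<n

perms-∈⁺ : ∀ n {σ} → IsPerm n σ → σ ∈ perms n
perms-∈⁺ n {σ} (length≡ , u , σ<n) =
  ∈-filter⁺ (T? ∘ distinct) {xs = words n n} (words-∈⁺ n n length≡ σ<n) (≡⇒T (Unique⇒distinct σ u))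

perms-Unique : ∀ n → Unique (perms n)
perms-Unique n = UP.filter⁺ (T? ∘ distinct) (words-Unique n n)

length-insert : ∀ xs {v : ℕ} {ys} → length (xs ++ v ∷ ys) ≡ suc (length (xs ++ ys))
length-insert []       = refl
length-insert (x ∷ xs) = cong suc (length-insert xs)

∈-∷ʳ⁻ : ∀ {v x : ℕ} γ → v ∈ γ ++ [ x ] → v ≢ x → v ∈ γ
∈-∷ʳ⁻ γ v∈ v≢x with ∈-++⁻ γ v∈
... | inj₁ v∈γ        = v∈γ
... | inj₂ (here v≡x) = ⊥-elim (v≢x v≡x)

∈-delete : ∀ {z x : ℕ} ys₁ {ys₂} → z ∈ ys₁ ++ x ∷ ys₂ → z ≢ x → z ∈ ys₁ ++ ys₂
∈-delete []        (here z≡x) z≢x = ⊥-elim (z≢x z≡x)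
∈-delete []        (there z∈) _   = z∈
∈-delete (y ∷ ys₁) (here z≡y) _   = here z≡y
∈-delete (y ∷ ys₁) (there z∈) z≢x = there (∈-delete ys₁ z∈ z≢x)

Unique-⊆⇒length≤ : ∀ {xs ys : List ℕ} → Unique xs → (∀ {x} → x ∈ xs → x ∈ ys) → length xs ≤ length ys
Unique-⊆⇒length≤ {[]}     _        _  = z≤n
Unique-⊆⇒length≤ {x ∷ xs} (x∉ ∷ u) xs⊆ with ys₁ , ys₂ , refl ← ∈-∃++ (xs⊆ (here refl)) =
  subst (suc (length xs) ≤_) (sym (length-insert ys₁))
    (s≤s (Unique-⊆⇒length≤ u λ z∈ → ∈-delete ys₁ (xs⊆ (there z∈)) (λ z≡x → All.lookup x∉ z∈ (sym z≡x))))

IsPerm⇒∈ : ∀ {n σ v} → IsPerm n σ → v < n → v ∈ σ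
IsPerm⇒∈ {n} {σ} {v} (length≡ , u , σ<n) v<n with v ∈? σ
... | yes v∈ = v∈
... | no  v∉ = ⊥-elim (<-irrefl refl (subst (_≤ n) (cong suc length≡) (subst (suc (length σ) ≤_) (length-upTo n)
                 (Unique-⊆⇒length≤ {v ∷ σ} {upTo n} (¬Any⇒All¬ σ v∉ ∷ u) ⊆upTo))))
  where
  ⊆upTo : ∀ {x} → x ∈ v ∷ σ → x ∈ upTo n
  ⊆upTo (here refl) = ∈-upTo⁺ v<n
  ⊆upTo (there x∈)  = ∈-upTo⁺ (All.lookup σ<n x∈)

Unique-insert : ∀ (xs : List ℕ) {v ys} → Unique (xs ++ ys) → v ∉ xs ++ ys → Unique (xs ++ v ∷ ys)
Unique-insert []       {ys = ys} u v∉ = ¬Any⇒All¬ ys v∉ ∷ u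
Unique-insert (x ∷ xs) {v} {ys} (x∉ ∷ u) v∉ =
  All.tabulate (λ z∈ → x≢z (∈-++⁻ xs z∈)) ∷ Unique-insert xs {v} {ys} u (v∉ ∘ there)
  where
  x≢z : ∀ {z} → z ∈ xs ⊎ z ∈ v ∷ ys → x ≢ z
  x≢z (inj₁ z∈)          refl = All¬⇒¬Any x∉ (∈-++⁺ˡ z∈)
  x≢z (inj₂ (here refl)) refl = v∉ (here refl)
  x≢z (inj₂ (there z∈))  refl = All¬⇒¬Any x∉ (∈-++⁺ʳ xs z∈)

∈-insert⁺ : ∀ {z : ℕ} xs {v ys} → z ∈ xs ++ ys → z ∈ xs ++ v ∷ ys
∈-insert⁺ xs z∈ with ∈-++⁻ xs z∈
... | inj₁ z∈xs = ∈-++⁺ˡ z∈xs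
... | inj₂ z∈ys = ∈-++⁺ʳ xs (there z∈ys)

Unique-delete : ∀ (xs : List ℕ) {v ys} → Unique (xs ++ v ∷ ys) → Unique (xs ++ ys) × (v ∉ xs ++ ys)
Unique-delete []       (v∉ ∷ u) = u , All¬⇒¬Any v∉
Unique-delete (x ∷ xs) {v} {ys} (x∉ ∷ u) with u′ , v∉ ← Unique-delete xs u =
  All.tabulate (λ z∈ → All.lookup x∉ (∈-insert⁺ xs z∈)) ∷ u′ , v∉′
  where
  v∉′ : v ∉ x ∷ xs ++ ys
  v∉′ (here refl) = All.lookup x∉ (∈-++⁺ʳ xs (here refl)) refl
  v∉′ (there v∈)  = v∉ v∈

Unique-++⁻ʳ : ∀ xs {ys : List ℕ} → Unique (xs ++ ys) → Unique ys
Unique-++⁻ʳ []       u       = u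
Unique-++⁻ʳ (x ∷ xs) (_ ∷ u) = Unique-++⁻ʳ xs u

Unique-∉ˡ : ∀ α {v : ℕ} {β} → Unique (α ++ v ∷ β) → v ∉ α
Unique-∉ˡ α u v∈ = proj₂ (Unique-delete α u) (∈-++⁺ˡ v∈)

Unique-∉ʳ : ∀ α {v : ℕ} {β} → Unique (α ++ v ∷ β) → v ∉ β
Unique-∉ʳ α u v∈ with v∉ ∷ _ ← Unique-++⁻ʳ α u = All.lookup v∉ v∈ refl

Unique-separates : ∀ α {v : ℕ} {β x y} → Unique (α ++ v ∷ β) → x ∈ α → y ∈ β → x ≢ y
Unique-separates (a ∷ α) (a∉ ∷ u) (here refl) y∈ = All.lookup a∉ (∈-++⁺ʳ α (there y∈))
Unique-separates (a ∷ α) (_ ∷ u)  (there x∈)  y∈ = Unique-separates α u x∈ y∈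

Unique-head : ∀ {x : ℕ} {xs} → Unique (x ∷ xs) → All (x ≢_) xs
Unique-head (x∉ ∷ _) = x∉

++-∷-cancel : ∀ γ γ′ {v : ℕ} {r r′} → v ∉ γ → v ∉ γ′ → γ ++ v ∷ r ≡ γ′ ++ v ∷ r′ → (γ ≡ γ′) × (r ≡ r′)
++-∷-cancel []      []       _  _   refl = refl , refl
++-∷-cancel []      (b ∷ γ′) _  v∉′ refl = ⊥-elim (v∉′ (here refl))
++-∷-cancel (a ∷ γ) []       v∉ _   refl = ⊥-elim (v∉ (here refl))
++-∷-cancel (a ∷ γ) (b ∷ γ′) v∉ v∉′ e
  with refl , e′ ← ∷-injective e
  with refl , refl ← ++-∷-cancel γ γ′ (v∉ ∘ there) (v∉′ ∘ there) e′ = refl , refl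

All<⇒∉ : ∀ {n} γ {δ} → All (_< n) (γ ++ δ) → n ∉ γ
All<⇒∉ γ <n n∈ = <-irrefl refl (All.lookup <n (∈-++⁺ˡ n∈))

IsPerm-insertMax : ∀ {n} xs ys → IsPerm n (xs ++ ys) → IsPerm (suc n) (xs ++ n ∷ ys)
IsPerm-insertMax {n} xs ys (length≡ , u , <n) =
  trans (length-insert xs) (cong suc length≡) ,
  Unique-insert xs {n} {ys} u (λ n∈ → <-irrefl refl (All.lookup <n n∈)) ,
  Allₚ.++⁺ (All.map m≤n⇒m≤1+n (Allₚ.++⁻ˡ xs <n)) (≤-refl ∷ All.map m≤n⇒m≤1+n (Allₚ.++⁻ʳ xs <n))

IsPerm-deleteMax : ∀ {n} xs ys → IsPerm (suc n) (xs ++ n ∷ ys) → IsPerm n (xs ++ ys)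
IsPerm-deleteMax {n} xs ys (length≡ , u , ≤n) with u′ , n∉ ← Unique-delete xs u =
  suc-injective (trans (sym (length-insert xs)) length≡) , u′ ,
  All.tabulate λ z∈ → ≤∧≢⇒< (s≤s⁻¹ (All.lookup ≤n (∈-insert⁺ xs z∈))) (λ { refl → n∉ z∈ })

All-map-suc : ∀ {n ρ} → All (_< n) ρ → All (_< suc n) (map suc ρ)
All-map-suc []         = []
All-map-suc (x<n ∷ <n) = s≤s x<n ∷ All-map-suc <n

0∉map-suc : ∀ ρ → 0 ∉ map suc ρ
0∉map-suc (x ∷ ρ) (there 0∈) = 0∉map-suc ρ 0∈

IsPerm-insertZero : ∀ {n} xs ys ρ → IsPerm n ρ → xs ++ ys ≡ map suc ρ → IsPerm (suc n) (xs ++ 0 ∷ ys)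
IsPerm-insertZero {n} xs ys ρ (length≡ , u , <n) xs++ys≡ =
  trans (length-insert xs) (cong suc (trans (cong length xs++ys≡) (trans (length-map suc ρ) length≡))) ,
  Unique-insert xs {0} {ys} (subst Unique (sym xs++ys≡) (UP.map⁺ suc-injective u)) (0∉map-suc ρ ∘ subst (0 ∈_) xs++ys≡) ,
  Allₚ.++⁺ (Allₚ.++⁻ˡ xs <suc-n) (z<s ∷ Allₚ.++⁻ʳ xs <suc-n)
  where
  <suc-n : All (_< suc n) (xs ++ ys)
  <suc-n = subst (All (_< suc n)) (sym xs++ys≡) (All-map-suc <n)

IsPerm-deleteZero : ∀ {n} xs ys → IsPerm (suc n) (xs ++ 0 ∷ ys) →
                    Σ (List ℕ) λ ρ → IsPerm n ρ × (xs ++ ys ≡ map suc ρ)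
IsPerm-deleteZero {n} xs ys (length≡ , u , <suc-n) with u′ , 0∉ ← Unique-delete xs u =
  map pred (xs ++ ys) ,
  (trans (length-map pred (xs ++ ys)) (suc-injective (trans (sym (length-insert xs)) length≡)) ,
   UP.map⁻ (subst Unique sucPred u′) ,
   All.tabulate pred<n) ,
  sucPred
  where
  sucPred : xs ++ ys ≡ map suc (map pred (xs ++ ys))
  sucPred = sym (trans (sym (map-∘ (xs ++ ys))) (map-suc∘pred (xs ++ ys) (λ z∈ z≡0 → 0∉ (subst (_∈ _) z≡0 z∈))))
    where
    map-suc∘pred : ∀ zs → (∀ {z} → z ∈ zs → z ≢ 0) → map (suc ∘ pred) zs ≡ zs
    map-suc∘pred []           _   = refl
    map-suc∘pred (zero ∷ zs)  ≢0 = ⊥-elim (≢0 (here refl) refl)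
    map-suc∘pred (suc z ∷ zs) ≢0 = cong (suc z ∷_) (map-suc∘pred zs (≢0 ∘ there))
  pred<n : ∀ {z} → z ∈ map pred (xs ++ ys) → z < n
  pred<n z∈ with ∈-map⁻ pred z∈
  ... | zero  , w∈ , refl = ⊥-elim (0∉ w∈)
  ... | suc w , w∈ , refl = s≤s⁻¹ (All.lookup <suc-n (∈-insert⁺ xs w∈))

snocView : ∀ (σ : List ℕ) {m} → length σ ≡ suc m → Σ (List ℕ) λ γ → Σ ℕ λ x → σ ≡ γ ++ [ x ]
snocView (a ∷ [])    _ = [] , a , refl
snocView (a ∷ b ∷ σ) _ with γ , x , e ← snocView (b ∷ σ) refl = a ∷ γ , x , cong (a ∷_) e

-- Counting by a decomposition

LL : Set
LL = List (List ℕ)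

countᵇ : (List ℕ → Bool) → LL → ℕ
countᵇ p xs = length (filterᵇ p xs)

∈-filterᵇ⁻ : ∀ {p : List ℕ → Bool} {xs : LL} {x} → x ∈ filterᵇ p xs → x ∈ xs × p x ≡ true
∈-filterᵇ⁻ {p} {xs} x∈ with x∈′ , px ← ∈-filter⁻ (T? ∘ p) {xs = xs} x∈ = x∈′ , T⇒≡ px

∈-filterᵇ⁺ : ∀ {p : List ℕ → Bool} {xs : LL} {x} → x ∈ xs → p x ≡ true → x ∈ filterᵇ p xs
∈-filterᵇ⁺ {p} {xs} x∈ px = ∈-filter⁺ (T? ∘ p) {xs = xs} x∈ (≡⇒T px)

countᵇ-↭ : ∀ p {xs ys} → xs ↭ ys → countᵇ p xs ≡ countᵇ p ys
countᵇ-↭ p xs↭ys = ↭-length (filter-↭ (T? ∘ p) xs↭ys)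

countᵇ-++ : ∀ p xs ys → countᵇ p (xs ++ ys) ≡ countᵇ p xs + countᵇ p ys
countᵇ-++ p []       ys = refl
countᵇ-++ p (x ∷ xs) ys with p x
... | true  = cong suc (countᵇ-++ p xs ys)
... | false = countᵇ-++ p xs ys

countᵇ-map : ∀ p (f : List ℕ → List ℕ) xs → countᵇ p (map f xs) ≡ countᵇ (p ∘ f) xs
countᵇ-map p f []       = refl
countᵇ-map p f (x ∷ xs) with p (f x)
... | true  = cong suc (countᵇ-map p f xs)
... | false = countᵇ-map p f xs

countᵇ-cong : ∀ {p q} xs → (∀ {x} → x ∈ xs → p x ≡ q x) → countᵇ p xs ≡ countᵇ q xs
countᵇ-cong []       _   = refl
countᵇ-cong {p} {q} (x ∷ xs) p≗q with p x | q x | p≗q (here refl)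
... | true  | true  | _ = cong suc (countᵇ-cong xs (p≗q ∘ there))
... | false | false | _ = countᵇ-cong xs (p≗q ∘ there)

countᵇ-none : ∀ {p} xs → (∀ {x} → x ∈ xs → p x ≡ false) → countᵇ p xs ≡ 0
countᵇ-none []       _  = refl
countᵇ-none {p} (x ∷ xs) ¬p with p x | ¬p (here refl)
... | false | _ = countᵇ-none xs (¬p ∘ there)

countᵇ-all : ∀ (xs : LL) → countᵇ (λ _ → true) xs ≡ length xs
countᵇ-all []       = refl
countᵇ-all (x ∷ xs) = cong suc (countᵇ-all xs)

filterᵇ-filterᵇ : ∀ (p q : List ℕ → Bool) (xs : LL) → filterᵇ p (filterᵇ q xs) ≡ filterᵇ (λ x → q x ∧ p x) xs
filterᵇ-filterᵇ p q []       = refl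
filterᵇ-filterᵇ p q (x ∷ xs) with q x
... | false = filterᵇ-filterᵇ p q xs
... | true with p x
...   | true  = cong (x ∷_) (filterᵇ-filterᵇ p q xs)
...   | false = filterᵇ-filterᵇ p q xs

filterᵇ-cong : ∀ {p q : List ℕ → Bool} (xs : LL) → (∀ x → p x ≡ q x) → filterᵇ p xs ≡ filterᵇ q xs
filterᵇ-cong []       _   = refl
filterᵇ-cong {p} {q} (x ∷ xs) p≗q with p x | q x | p≗q x
... | true  | true  | _ = cong (x ∷_) (filterᵇ-cong xs p≗q)
... | false | false | _ = filterᵇ-cong xs p≗q

Unique-map-injectiveOn : ∀ {f : List ℕ → List ℕ} {xs : LL} → Unique xs →
  (∀ {x y} → x ∈ xs → y ∈ xs → f x ≡ f y → x ≡ y) → Unique (map f xs)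
Unique-map-injectiveOn {f} {[]}     _        _   = []
Unique-map-injectiveOn {f} {x ∷ xs} (x∉ ∷ u) inj =
  images x∉ (inj (here refl) ∘ there) ∷ Unique-map-injectiveOn u (λ x∈ y∈ → inj (there x∈) (there y∈))
  where
  images : ∀ {ys} → All (x ≢_) ys → (∀ {y} → y ∈ ys → f x ≡ f y → x ≡ y) → All (f x ≢_) (map f ys)
  images []          _   = []
  images (x≢y ∷ x∉) inj′ = (x≢y ∘ inj′ (here refl)) ∷ images x∉ (inj′ ∘ there)

record Decomposition (T S₁ S₂ : LL) (f g : List ℕ → List ℕ) : Set where
  field
    image₁     : ∀ {ρ} → ρ ∈ S₁ → f ρ ∈ T
    image₂     : ∀ {ρ} → ρ ∈ S₂ → g ρ ∈ T
    injective₁ : ∀ {x y} → x ∈ S₁ → y ∈ S₁ → f x ≡ f y → x ≡ y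
    injective₂ : ∀ {x y} → x ∈ S₂ → y ∈ S₂ → g x ≡ g y → x ≡ y
    disjoint   : ∀ {x y} → x ∈ S₁ → y ∈ S₂ → f x ≢ g y
    cover      : ∀ {σ} → σ ∈ T → (Σ (List ℕ) λ ρ → ρ ∈ S₁ × σ ≡ f ρ) ⊎ (Σ (List ℕ) λ ρ → ρ ∈ S₂ × σ ≡ g ρ)

countᵇ-decompose : ∀ {T S₁ S₂ f g} → Unique T → Unique S₁ → Unique S₂ → Decomposition T S₁ S₂ f g →
  ∀ p → countᵇ p T ≡ countᵇ (p ∘ f) S₁ + countᵇ (p ∘ g) S₂
countᵇ-decompose {T} {S₁} {S₂} {f} {g} uT u₁ u₂ d p = begin
  countᵇ p T                                      ≡⟨ countᵇ-↭ p T↭images ⟩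
  countᵇ p (map f S₁ ++ map g S₂)                 ≡⟨ countᵇ-++ p (map f S₁) (map g S₂) ⟩
  countᵇ p (map f S₁) + countᵇ p (map g S₂)       ≡⟨ cong₂ _+_ (countᵇ-map p f S₁) (countᵇ-map p g S₂) ⟩
  countᵇ (p ∘ f) S₁ + countᵇ (p ∘ g) S₂           ∎
  where
  open Decomposition d
  open ≡-Reasoning
  images-Unique : Unique (map f S₁ ++ map g S₂)
  images-Unique = UP.++⁺ (Unique-map-injectiveOn u₁ injective₁) (Unique-map-injectiveOn u₂ injective₂) separated
    where
    separated : Disjoint (map f S₁) (map g S₂)
    separated (z∈₁ , z∈₂) with x , x∈ , refl ← ∈-map⁻ f z∈₁ with y , y∈ , e ← ∈-map⁻ g z∈₂ = disjoint x∈ y∈ e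
  T↭images : T ↭ map f S₁ ++ map g S₂
  T↭images = ∼bag⇒↭ (unique∧set⇒bag uT images-Unique (mk⇔ to from))
    where
    to : ∀ {z} → z ∈ T → z ∈ map f S₁ ++ map g S₂
    to z∈ with cover z∈
    ... | inj₁ (ρ , ρ∈ , refl) = ∈-++⁺ˡ (∈-map⁺ f ρ∈)
    ... | inj₂ (ρ , ρ∈ , refl) = ∈-++⁺ʳ (map f S₁) (∈-map⁺ g ρ∈)
    from : ∀ {z} → z ∈ map f S₁ ++ map g S₂ → z ∈ T
    from z∈ with ∈-++⁻ (map f S₁) z∈
    ... | inj₁ z∈₁ with _ , x∈ , refl ← ∈-map⁻ f z∈₁ = image₁ x∈
    ... | inj₂ z∈₂ with _ , y∈ , refl ← ∈-map⁻ g z∈₂ = image₂ y∈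

-- Permutations avoiding 312 and a second pattern

Avoiders : List ℕ → ℕ → LL
Avoiders τ n = filterᵇ (λ σ → avoids σ p312 ∧ avoids σ τ) (perms n)

IsAvoider : List ℕ → ℕ → List ℕ → Set
IsAvoider τ n σ = IsPerm n σ × (avoids σ p312 ≡ true) × (avoids σ τ ≡ true)

Avoiders-∈⁻ : ∀ τ n {σ} → σ ∈ Avoiders τ n → IsAvoider τ n σ
Avoiders-∈⁻ τ n {σ} σ∈ with σ∈′ , av ← ∈-filter⁻ (λ s → T? (avoids s p312 ∧ avoids s τ)) {xs = perms n} σ∈ =
  perms-∈⁻ n σ∈′ , ∧≡true⇒ˡ _ (T⇒≡ av) , ∧≡true⇒ʳ (avoids σ p312) (T⇒≡ av)

Avoiders-∈⁺ : ∀ τ n {σ} → IsAvoider τ n σ → σ ∈ Avoiders τ n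
Avoiders-∈⁺ τ n (isPerm , av₁ , av₂) =
  ∈-filter⁺ (λ s → T? (avoids s p312 ∧ avoids s τ)) {xs = perms n} (perms-∈⁺ n isPerm) (≡⇒T (∧≡true av₁ av₂))

Avoiders-Unique : ∀ τ n → Unique (Avoiders τ n)
Avoiders-Unique τ n = UP.filter⁺ (λ s → T? (avoids s p312 ∧ avoids s τ)) (perms-Unique n)

count≡countᵇ-Avoiders : ∀ τ n k → count τ n k ≡ countᵇ (λ σ → lis σ ≡ᵇ k) (Avoiders τ n)
count≡countᵇ-Avoiders τ n k = cong length (trans
  (filterᵇ-cong (perms n) (λ σ → sym (∧-assoc (avoids σ p312) (avoids σ τ) (lis σ ≡ᵇ k))))
  (sym (filterᵇ-filterᵇ (λ σ → lis σ ≡ᵇ k) (λ σ → avoids σ p312 ∧ avoids σ τ) (perms n))))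

-- Extending a permutation of [n] by a new minimum or maximum

appendMax : ℕ → List ℕ → List ℕ
appendMax n ρ = ρ ++ [ n ]

appendMin : List ℕ → List ℕ
appendMin ρ = map suc ρ ++ [ 0 ]

prependMin : List ℕ → List ℕ
prependMin ρ = 0 ∷ map suc ρ

length-∷ʳ : ∀ (s : List ℕ) v → length (s ++ [ v ]) ≡ suc (length s)
length-∷ʳ [] v = refl
length-∷ʳ (x ∷ s) v = cong suc (length-∷ʳ s v)

lis-∷-positive : ∀ {a ρ} → 1 ≤ lis (a ∷ ρ)
lis-∷-positive {a} {ρ} = length≤lis {a ∷ ρ} {[ a ]} (keep done) (increasing✓ refl)

lis-map-suc : ∀ ρ → lis (map suc ρ) ≡ lis ρ
lis-map-suc ρ with lis-witness ρ
... | s , p , i , l =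
  lis≡ (⊑-map⁺ suc p) (increasing✓ (trans (increasing-map-suc s) (increasing≡true i))) (trans (length-map suc s) l) bound
  where
  bound : ∀ s′ → s′ ⊑ map suc ρ → Increasing s′ → length s′ ≤ lis ρ
  bound s′ q i′ with ⊑-map⁻ suc q
  ... | s′′ , refl , q′ = subst (_≤ lis ρ) (sym (length-map suc s′′))
          (length≤lis q′ (increasing✓ (trans (sym (increasing-map-suc s′′)) (increasing≡true i′))))

lis-appendMax : ∀ {ρ v} → All (_< v) ρ → lis (appendMax v ρ) ≡ suc (lis ρ)
lis-appendMax {ρ} {v} ρ<v with lis-witness ρ
... | s , p , i , l = lis≡ (⊑-++ p (keep done)) (inc-∷ʳ s i (All-⊑ p ρ<v)) (trans (length-∷ʳ s v) (cong suc l)) bound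
  where
  bound : ∀ s′ → s′ ⊑ ρ ++ [ v ] → Increasing s′ → length s′ ≤ suc (lis ρ)
  bound s′ q i′ with ⊑-split ρ v [] q
  ... | inj₁ q′ = m≤n⇒m≤1+n (length≤lis (subst (s′ ⊑_) (++-identityʳ ρ) q′) i′)
  ... | inj₂ (s₁ , s₂ , refl , q₁ , q₂) with ⊑-[] q₂
  ... | refl = subst (_≤ suc (lis ρ)) (sym (length-∷ʳ s₁ v)) (s≤s (length≤lis q₁ (inc-++ˡ s₁ i′)))

lis-appendMin : ∀ {a ρ} → lis (appendMin (a ∷ ρ)) ≡ lis (a ∷ ρ)
lis-appendMin {a} {ρ} with lis-witness (map suc (a ∷ ρ))
... | s , p , i , l = lis≡ (⊑-++ʳ [ 0 ] p) i (trans l (lis-map-suc (a ∷ ρ))) bound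
  where
  bound : ∀ s′ → s′ ⊑ map suc (a ∷ ρ) ++ [ 0 ] → Increasing s′ → length s′ ≤ lis (a ∷ ρ)
  bound s′ q i′ with ⊑-split (map suc (a ∷ ρ)) 0 [] q
  ... | inj₁ q′ = subst (length s′ ≤_) (lis-map-suc (a ∷ ρ)) (length≤lis (subst (s′ ⊑_) (++-identityʳ _) q′) i′)
  ... | inj₂ ([] , s₂ , refl , q₁ , q₂) with ⊑-[] q₂
  ... | refl = lis-∷-positive {a} {ρ}
  bound s′ q i′ | inj₂ (b ∷ s₁ , s₂ , refl , q₁ , q₂) = ⊥-elim (n≮0 (inc-++-< (b ∷ s₁) i′ (here refl) (here refl)))

All-map-suc-positive : ∀ ρ → All (0 <_) (map suc ρ)
All-map-suc-positive [] = []
All-map-suc-positive (x ∷ ρ) = s≤s z≤n ∷ All-map-suc-positive ρ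

lis-prependMin : ∀ ρ → lis (prependMin ρ) ≡ suc (lis ρ)
lis-prependMin ρ with lis-witness (map suc ρ)
... | s , p , i , l = lis≡ (keep p) (inc-cons (All-⊑ p (All-map-suc-positive ρ)) i) (cong suc (trans l (lis-map-suc ρ))) bound
  where
  bound : ∀ s′ → s′ ⊑ 0 ∷ map suc ρ → Increasing s′ → length s′ ≤ suc (lis ρ)
  bound s′ done i′ = z≤n
  bound s′ (skip q) i′ = m≤n⇒m≤1+n (subst (length s′ ≤_) (lis-map-suc ρ) (length≤lis q i′))
  bound (.0 ∷ s′′) (keep q) i′ = s≤s (subst (length s′′ ≤_) (lis-map-suc ρ) (length≤lis q (inc-tail i′)))

lis-insertBefore : ∀ {n} γ δ → All (_< suc n) (γ ++ n ∷ δ) → n ∉ γ → lis (γ ++ suc n ∷ n ∷ δ) ≡ lis (γ ++ n ∷ δ)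
lis-insertBefore {n} γ δ ≤n n∉γ with lis-witness (γ ++ n ∷ δ)
... | s , p , i , l = lis≡ (⊑-insert γ (suc n) p) i l bound
  where
  bound : ∀ s′ → s′ ⊑ γ ++ suc n ∷ n ∷ δ → Increasing s′ → length s′ ≤ lis (γ ++ n ∷ δ)
  bound s′ q i′ with ⊑-split γ (suc n) (n ∷ δ) q
  ... | inj₁ q′ = length≤lis q′ i′
  ... | inj₂ (s₁ , [] , refl , q₁ , q₂) =
        subst (_≤ _) (trans (length-∷ʳ s₁ n) (sym (length-∷ʳ s₁ (suc n))))
          (length≤lis (⊑-++ q₁ (keep done)) (inc-∷ʳ s₁ (inc-++ˡ s₁ i′) (All.tabulate s₁<n)))
    where
    s₁<n : ∀ {x} → x ∈ s₁ → x < n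
    s₁<n x∈ = ≤∧≢⇒< (s≤s⁻¹ (All.lookup ≤n (∈-++⁺ˡ (⊑-∈ q₁ x∈)))) (λ x≡n → n∉γ (subst (_∈ γ) x≡n (⊑-∈ q₁ x∈)))
  ... | inj₂ (s₁ , y ∷ s₂ , refl , q₁ , q₂) =
        ⊥-elim (<-asym (inc-++-< (s₁ ++ [ suc n ]) (subst Increasing (sym (++-assoc s₁ [ suc n ] (y ∷ s₂))) i′) (∈-++⁺ʳ s₁ (here refl)) (here refl))
                  (All.lookup ≤n (∈-++⁺ʳ γ (⊑-∈ q₂ (here refl)))))

lis-insertPenultimate : ∀ {n} γ x → All (_< n) (γ ++ [ x ]) → lis (γ ++ n ∷ [ x ]) ≡ suc (lis γ)
lis-insertPenultimate {n} γ x <n with lis-witness γ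
... | s , p , i , l = lis≡ (⊑-++ p (keep done)) (inc-∷ʳ s i (All-⊑ p (Allₚ.++⁻ˡ γ <n))) (trans (length-∷ʳ s n) (cong suc l)) bound
  where
  bound : ∀ s′ → s′ ⊑ γ ++ n ∷ [ x ] → Increasing s′ → length s′ ≤ suc (lis γ)
  bound s′ q i′ with ⊑-split γ n [ x ] q
  ... | inj₂ (s₁ , s₂ , refl , q₁ , q₂) with ⊑-singleton q₂
  ... | inj₁ refl = subst (_≤ _) (sym (length-∷ʳ s₁ n)) (s≤s (length≤lis q₁ (inc-++ˡ s₁ i′)))
  ... | inj₂ refl = ⊥-elim (<-asym (All.lookup <n (∈-++⁺ʳ γ (here refl)))
          (inc-++-< (s₁ ++ [ n ]) (subst Increasing (sym (++-assoc s₁ [ n ] [ x ])) i′) (∈-++⁺ʳ s₁ (here refl)) (here refl)))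
  bound s′ q i′ | inj₁ q′ with ⊑-split γ x [] q′
  ... | inj₁ q′′ = m≤n⇒m≤1+n (length≤lis (subst (s′ ⊑_) (++-identityʳ γ) q′′) i′)
  ... | inj₂ (s₁ , s₂ , refl , q₁ , q₂) with ⊑-[] q₂
  ... | refl = subst (_≤ _) (sym (length-∷ʳ s₁ x)) (s≤s (length≤lis q₁ (inc-++ˡ s₁ i′)))

appendMax-injective : ∀ {n x y} → appendMax n x ≡ appendMax n y → x ≡ y
appendMax-injective {x = x} {y} = ∷ʳ-injectiveˡ x y

appendMin-injective : ∀ {x y} → appendMin x ≡ appendMin y → x ≡ y
appendMin-injective {x} {y} e = map-injective suc-injective (∷ʳ-injectiveˡ (map suc x) (map suc y) e)

prependMin-injective : ∀ {x y} → prependMin x ≡ prependMin y → x ≡ y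
prependMin-injective e = map-injective suc-injective (proj₂ (∷-injective e))

appendMin≢appendMax : ∀ {n x y} → 1 ≤ n → appendMin x ≢ appendMax n y
appendMin≢appendMax {x = x} {y} 1≤n e = <⇒≢ 1≤n (∷ʳ-injectiveʳ (map suc x) y e)

IsPerm-appendMax : ∀ {n ρ} → IsPerm n ρ → IsPerm (suc n) (appendMax n ρ)
IsPerm-appendMax {ρ = ρ} isPerm = IsPerm-insertMax ρ [] (subst (IsPerm _) (sym (++-identityʳ ρ)) isPerm)

IsPerm-appendMin : ∀ {n ρ} → IsPerm n ρ → IsPerm (suc n) (appendMin ρ)
IsPerm-appendMin {ρ = ρ} isPerm = IsPerm-insertZero (map suc ρ) [] ρ isPerm (++-identityʳ _)

IsPerm-prependMin : ∀ {n ρ} → IsPerm n ρ → IsPerm (suc n) (prependMin ρ)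
IsPerm-prependMin {ρ = ρ} isPerm = IsPerm-insertZero [] (map suc ρ) ρ isPerm refl

IsPerm-nonempty : ∀ {n ρ} → 1 ≤ n → IsPerm n ρ → Σ ℕ λ a → Σ (List ℕ) λ r → ρ ≡ a ∷ r
IsPerm-nonempty {ρ = a ∷ r} _ _ = a , r , refl
IsPerm-nonempty {ρ = []} 1≤n (refl , _) with () ← 1≤n

EndsAboveMin EndsBelowMax StartsAboveMin : List ℕ → Set
EndsAboveMin   τ = ∀ x y → matches τ x y 0 ≡ true → ⊥
EndsBelowMax   τ = ∀ {n} x y → x < n → y < n → matches τ x y n ≡ true → ⊥
StartsAboveMin τ = ∀ y z → 0 < y → 0 < z → matches τ 0 y z ≡ true → ⊥

avoids-appendMin : ∀ {ρ} t₁ t₂ t₃ → EndsAboveMin (t₁ ∷ t₂ ∷ t₃ ∷ []) →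
  avoids ρ (t₁ ∷ t₂ ∷ t₃ ∷ []) ≡ true → avoids (appendMin ρ) (t₁ ∷ t₂ ∷ t₃ ∷ []) ≡ true
avoids-appendMin {ρ} t₁ t₂ t₃ endsAbove av =
  avoids-insert (map suc ρ) 0 [] t₁ t₂ t₃
    (subst (λ σ → avoids σ (t₁ ∷ t₂ ∷ t₃ ∷ []) ≡ true) (sym (++-identityʳ (map suc ρ))) (avoids-map-suc⁺ {ρ} t₁ t₂ t₃ av))
    (λ _ _ ()) (λ _ _ _ ()) (λ x y _ → endsAbove x y)

avoids-appendMax : ∀ {n ρ} t₁ t₂ t₃ → All (_< n) ρ → EndsBelowMax (t₁ ∷ t₂ ∷ t₃ ∷ []) →
  avoids ρ (t₁ ∷ t₂ ∷ t₃ ∷ []) ≡ true → avoids (appendMax n ρ) (t₁ ∷ t₂ ∷ t₃ ∷ []) ≡ true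
avoids-appendMax {n} {ρ} t₁ t₂ t₃ ρ<n endsBelow av =
  avoids-insert ρ n [] t₁ t₂ t₃ (subst (λ σ → avoids σ (t₁ ∷ t₂ ∷ t₃ ∷ []) ≡ true) (sym (++-identityʳ ρ)) av)
    (λ _ _ ()) (λ _ _ _ ()) (λ x y p → endsBelow x y (All.lookup ρ<n (proj₁ (⊑-pair⇒∈ p))) (All.lookup ρ<n (proj₂ (⊑-pair⇒∈ p))))

avoids-prependMin : ∀ {ρ} t₁ t₂ t₃ → StartsAboveMin (t₁ ∷ t₂ ∷ t₃ ∷ []) →
  avoids ρ (t₁ ∷ t₂ ∷ t₃ ∷ []) ≡ true → avoids (prependMin ρ) (t₁ ∷ t₂ ∷ t₃ ∷ []) ≡ true
avoids-prependMin {ρ} t₁ t₂ t₃ startsAbove av =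
  avoids-insert [] 0 (map suc ρ) t₁ t₂ t₃ (avoids-map-suc⁺ {ρ} t₁ t₂ t₃ av)
    (λ y z p → startsAbove y z (∈-map-suc⇒positive (proj₁ (⊑-pair⇒∈ p))) (∈-map-suc⇒positive (proj₂ (⊑-pair⇒∈ p))))
    (λ { _ _ () _ }) (λ { _ _ () })
  where
  ∈-map-suc⇒positive : ∀ {y ρ} → y ∈ map suc ρ → 0 < y
  ∈-map-suc⇒positive {ρ = _ ∷ _} (here refl) = z<s
  ∈-map-suc⇒positive {ρ = _ ∷ _} (there y∈) = ∈-map-suc⇒positive y∈

endsAboveMin-312 : EndsAboveMin p312
endsAboveMin-312 x y m = n≮0 (proj₂ (proj₂ (matches-312⁻ x y 0 m)))

endsBelowMax-312 : EndsBelowMax p312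
endsBelowMax-312 {n} x y x<n _ m = <⇒≱ x<n (proj₁ (proj₂ (matches-312⁻ x y n m)))

startsAboveMin-312 : StartsAboveMin p312
startsAboveMin-312 y z 0<y _ m = <⇒≱ 0<y (proj₁ (matches-312⁻ 0 y z m))

module Extensions (t₁ t₂ t₃ : ℕ) where

  τ : List ℕ
  τ = t₁ ∷ t₂ ∷ t₃ ∷ []

  appendMin-∈ : EndsAboveMin τ → ∀ n {ρ} → ρ ∈ Avoiders τ n → appendMin ρ ∈ Avoiders τ (suc n)
  appendMin-∈ endsAbove n {ρ} ρ∈ with isPerm , av₁ , av₂ ← Avoiders-∈⁻ τ n ρ∈ =
    Avoiders-∈⁺ τ (suc n) (IsPerm-appendMin isPerm ,
      avoids-appendMin {ρ} 3 1 2 endsAboveMin-312 av₁ , avoids-appendMin {ρ} t₁ t₂ t₃ endsAbove av₂)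

  appendMax-∈ : EndsBelowMax τ → ∀ n {ρ} → ρ ∈ Avoiders τ n → appendMax n ρ ∈ Avoiders τ (suc n)
  appendMax-∈ endsBelow n ρ∈ with isPerm@(_ , _ , ρ<n) , av₁ , av₂ ← Avoiders-∈⁻ τ n ρ∈ =
    Avoiders-∈⁺ τ (suc n) (IsPerm-appendMax isPerm ,
      avoids-appendMax 3 1 2 ρ<n endsBelowMax-312 av₁ , avoids-appendMax t₁ t₂ t₃ ρ<n endsBelow av₂)

  prependMin-∈ : StartsAboveMin τ → ∀ n {ρ} → ρ ∈ Avoiders τ n → prependMin ρ ∈ Avoiders τ (suc n)
  prependMin-∈ startsAbove n {ρ} ρ∈ with isPerm , av₁ , av₂ ← Avoiders-∈⁻ τ n ρ∈ =
    Avoiders-∈⁺ τ (suc n) (IsPerm-prependMin isPerm ,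
      avoids-prependMin {ρ} 3 1 2 startsAboveMin-312 av₁ , avoids-prependMin {ρ} t₁ t₂ t₃ startsAbove av₂)

  sublist-∈ : ∀ {n ρ σ} → IsPerm n ρ → ρ ⊑ σ → σ ∈ Avoiders τ (suc n) → ρ ∈ Avoiders τ n
  sublist-∈ {n} isPerm ρ⊑σ σ∈ with _ , av₁ , av₂ ← Avoiders-∈⁻ τ (suc n) σ∈ =
    Avoiders-∈⁺ τ n (isPerm , avoids-⊑ 3 1 2 ρ⊑σ av₁ , avoids-⊑ t₁ t₂ t₃ ρ⊑σ av₂)

  appendMax⁻¹-∈ : ∀ n γ → γ ++ [ n ] ∈ Avoiders τ (suc n) → γ ∈ Avoiders τ n
  appendMax⁻¹-∈ n γ σ∈ with isPerm , _ ← Avoiders-∈⁻ τ (suc n) σ∈ =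
    sublist-∈ (subst (IsPerm n) (++-identityʳ γ) (IsPerm-deleteMax γ [] isPerm)) (⊑-∷ʳ γ n) σ∈

  relabel-∈ : ∀ {n ρ σ} → IsPerm n ρ → map suc ρ ⊑ σ → σ ∈ Avoiders τ (suc n) → ρ ∈ Avoiders τ n
  relabel-∈ {n} {ρ} isPerm ρ⊑σ σ∈ with _ , av₁ , av₂ ← Avoiders-∈⁻ τ (suc n) σ∈ =
    Avoiders-∈⁺ τ n (isPerm ,
      avoids-map-suc⁻ {ρ} 3 1 2 (avoids-⊑ 3 1 2 ρ⊑σ av₁) , avoids-map-suc⁻ {ρ} t₁ t₂ t₃ (avoids-⊑ t₁ t₂ t₃ ρ⊑σ av₂))

  appendMin⁻¹-∈ : ∀ n γ → γ ++ [ 0 ] ∈ Avoiders τ (suc n) →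
                  Σ (List ℕ) λ ρ → ρ ∈ Avoiders τ n × γ ++ [ 0 ] ≡ appendMin ρ
  appendMin⁻¹-∈ n γ σ∈ with isPerm , _ ← Avoiders-∈⁻ τ (suc n) σ∈
                            with ρ , isPermρ , γ≡ ← IsPerm-deleteZero γ [] isPerm =
    ρ , relabel-∈ isPermρ (subst (_⊑ γ ++ [ 0 ]) γ≡′ (⊑-∷ʳ γ 0)) σ∈ , cong (_++ [ 0 ]) γ≡′
    where
    γ≡′ : γ ≡ map suc ρ
    γ≡′ = trans (sym (++-identityʳ γ)) γ≡

  prependMin⁻¹-∈ : ∀ n δ → 0 ∷ δ ∈ Avoiders τ (suc n) →
                   Σ (List ℕ) λ ρ → ρ ∈ Avoiders τ n × 0 ∷ δ ≡ prependMin ρ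
  prependMin⁻¹-∈ n δ σ∈ with isPerm , _ ← Avoiders-∈⁻ τ (suc n) σ∈
                             with ρ , isPermρ , δ≡ ← IsPerm-deleteZero [] δ isPerm =
    ρ , relabel-∈ isPermρ (subst (_⊑ 0 ∷ δ) δ≡ (skip (⊑-refl δ))) σ∈ , cong (0 ∷_) δ≡

  lis-appendMin-∈ : ∀ {n ρ} → 1 ≤ n → ρ ∈ Avoiders τ n → lis (appendMin ρ) ≡ lis ρ
  lis-appendMin-∈ {n} 1≤n ρ∈ with a , r , refl ← IsPerm-nonempty 1≤n (proj₁ (Avoiders-∈⁻ τ n ρ∈)) = lis-appendMin {a} {r}

  lis-appendMax-∈ : ∀ n {ρ} → ρ ∈ Avoiders τ n → lis (appendMax n ρ) ≡ suc (lis ρ)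
  lis-appendMax-∈ n ρ∈ with (_ , _ , ρ<n) , _ ← Avoiders-∈⁻ τ n ρ∈ = lis-appendMax ρ<n

-- Recurrences for the five patterns

count-decompose : ∀ τ n {f g} → Decomposition (Avoiders τ (suc n)) (Avoiders τ n) (Avoiders τ n) f g → ∀ k →
  count τ (suc n) k ≡ countᵇ (λ ρ → lis (f ρ) ≡ᵇ k) (Avoiders τ n) + countᵇ (λ ρ → lis (g ρ) ≡ᵇ k) (Avoiders τ n)
count-decompose τ n d k = trans (count≡countᵇ-Avoiders τ (suc n) k)
  (countᵇ-decompose (Avoiders-Unique τ (suc n)) (Avoiders-Unique τ n) (Avoiders-Unique τ n) d (λ σ → lis σ ≡ᵇ k))

pascal-step : ∀ τ n →
  (∀ k → count τ (suc n) k ≡ count τ n k + countᵇ (λ ρ → suc (lis ρ) ≡ᵇ k) (Avoiders τ n)) →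
  (count τ (suc n) 0 ≡ count τ n 0) × (∀ k → count τ (suc n) (suc k) ≡ count τ n (suc k) + count τ n k)
pascal-step τ n step =
  trans (step 0) (trans (cong (count τ n 0 +_) (countᵇ-none (Avoiders τ n) (λ _ → refl))) (+-identityʳ _)) ,
  λ k → trans (step (suc k)) (cong (count τ n (suc k) +_) (sym (count≡countᵇ-Avoiders τ n k)))

-- The last entry of a 132- and 312-avoider is its minimum 0 or its maximum n: otherwise
-- 0 and n both precede it and form, together with it, a 132 or a 312.
module Avoiders132 (n : ℕ) (1≤n : 1 ≤ n) where

  open Extensions 1 3 2

  endsAboveMin : EndsAboveMin τ
  endsAboveMin x y m = n≮0 (proj₁ (proj₂ (matches-132⁻ x y 0 m)))

  endsBelowMax : EndsBelowMax τ
  endsBelowMax {n} x y _ y<n m = <⇒≱ y<n (proj₂ (proj₂ (matches-132⁻ x y n m)))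

  cover : ∀ {σ} → σ ∈ Avoiders τ (suc n) →
    (Σ (List ℕ) λ ρ → ρ ∈ Avoiders τ n × σ ≡ appendMin ρ) ⊎ (Σ (List ℕ) λ ρ → ρ ∈ Avoiders τ n × σ ≡ appendMax n ρ)
  cover {σ} σ∈ with Avoiders-∈⁻ τ (suc n) σ∈
  ... | isPerm@(length≡ , _ , σ≤n) , av₁ , av₂ with snocView σ length≡
  ... | γ , x , refl with x ≟ n | x ≟ 0
  ...   | yes refl | _        = inj₂ (γ , appendMax⁻¹-∈ n γ σ∈ , refl)
  ...   | no _     | yes refl = inj₁ (appendMin⁻¹-∈ n γ σ∈)
  ...   | no x≢n   | no x≢0   with ⊑-pair-either 0∈γ n∈γ (<⇒≢ 1≤n)
    where
    0∈γ : 0 ∈ γ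
    0∈γ = ∈-∷ʳ⁻ γ (IsPerm⇒∈ isPerm z<s) (x≢0 ∘ sym)
    n∈γ : n ∈ γ
    n∈γ = ∈-∷ʳ⁻ γ (IsPerm⇒∈ isPerm ≤-refl) (x≢n ∘ sym)
  ... | inj₁ 0n = ⊥-elim (avoids⁻ p132 (⊑-++ 0n (keep done)) av₂ (matches-132⁺ 0 n x 1≤n 0<x (<⇒≤ x<n)))
    where
    0<x = ≤∧≢⇒< z≤n (x≢0 ∘ sym)
    x<n = ≤∧≢⇒< (s≤s⁻¹ (All.lookup σ≤n (∈-++⁺ʳ γ (here refl)))) x≢n
  ... | inj₂ n0 = ⊥-elim (avoids⁻ p312 (⊑-++ n0 (keep done)) av₁ (matches-312⁺ n 0 x z≤n (<⇒≤ x<n) 0<x))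
    where
    0<x = ≤∧≢⇒< z≤n (x≢0 ∘ sym)
    x<n = ≤∧≢⇒< (s≤s⁻¹ (All.lookup σ≤n (∈-++⁺ʳ γ (here refl)))) x≢n

  decomposition : Decomposition (Avoiders τ (suc n)) (Avoiders τ n) (Avoiders τ n) appendMin (appendMax n)
  decomposition = record
    { image₁     = appendMin-∈ endsAboveMin n
    ; image₂     = appendMax-∈ endsBelowMax n
    ; injective₁ = λ _ _ → appendMin-injective
    ; injective₂ = λ _ _ → appendMax-injective
    ; disjoint   = λ _ _ → appendMin≢appendMax 1≤n
    ; cover      = cover
    }

  count-step : ∀ k → count τ (suc n) k ≡ count τ n k + countᵇ (λ ρ → suc (lis ρ) ≡ᵇ k) (Avoiders τ n)
  count-step k = trans (count-decompose τ n decomposition k) (cong₂ _+_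
    (trans (countᵇ-cong (Avoiders τ n) λ ρ∈ → cong (_≡ᵇ k) (lis-appendMin-∈ 1≤n ρ∈)) (sym (count≡countᵇ-Avoiders τ n k)))
    (countᵇ-cong (Avoiders τ n) λ ρ∈ → cong (_≡ᵇ k) (lis-appendMax-∈ n ρ∈)))

  recurrence : (count τ (suc n) 0 ≡ count τ n 0) × (∀ k → count τ (suc n) (suc k) ≡ count τ n (suc k) + count τ n k)
  recurrence = pascal-step τ n count-step

-- In a 213- and 312-avoider the entry 0 is first or last: otherwise its neighbours g and d
-- form, together with it, a 213 (if g < d) or a 312 (if g > d).
module Avoiders213 (n : ℕ) (1≤n : 1 ≤ n) where

  open Extensions 2 1 3

  startsAboveMin : StartsAboveMin τ
  startsAboveMin y z 0<y _ m = <⇒≱ 0<y (proj₁ (matches-213⁻ 0 y z m))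

  endsAboveMin : EndsAboveMin τ
  endsAboveMin x y m = n≮0 (proj₁ (proj₂ (matches-213⁻ x y 0 m)))

  cover : ∀ {σ} → σ ∈ Avoiders τ (suc n) →
    (Σ (List ℕ) λ ρ → ρ ∈ Avoiders τ n × σ ≡ prependMin ρ) ⊎ (Σ (List ℕ) λ ρ → ρ ∈ Avoiders τ n × σ ≡ appendMin ρ)
  cover {σ} σ∈ with Avoiders-∈⁻ τ (suc n) σ∈
  ... | isPerm@(_ , u , _) , av₁ , av₂ with ∈-∃++ (IsPerm⇒∈ isPerm z<s)
  ... | []    , δ     , refl = inj₁ (prependMin⁻¹-∈ n δ σ∈)
  ... | g ∷ γ , []    , refl = inj₂ (appendMin⁻¹-∈ n (g ∷ γ) σ∈)
  ... | g ∷ γ , d ∷ δ , refl with <-cmp g d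
  ...   | tri< g<d _ _ = ⊥-elim (avoids⁻ p213 occurrence av₂ (matches-213⁺ g 0 d z≤n g<d 0<d))
    where
    occurrence = keep (⊑-++ˡ γ (keep (keep done)))
    0<d = ≤∧≢⇒< z≤n (λ 0≡d → Unique-∉ʳ (g ∷ γ) u (here 0≡d))
  ...   | tri≈ _ g≡d _ = ⊥-elim (Unique-separates (g ∷ γ) u (here refl) (here refl) g≡d)
  ...   | tri> _ _ d<g = ⊥-elim (avoids⁻ p312 occurrence av₁ (matches-312⁺ g 0 d z≤n (<⇒≤ d<g) 0<d))
    where
    occurrence = keep (⊑-++ˡ γ (keep (keep done)))
    0<d = ≤∧≢⇒< z≤n (λ 0≡d → Unique-∉ʳ (g ∷ γ) u (here 0≡d))

  decomposition : Decomposition (Avoiders τ (suc n)) (Avoiders τ n) (Avoiders τ n) prependMin appendMin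
  decomposition = record
    { image₁     = prependMin-∈ startsAboveMin n
    ; image₂     = appendMin-∈ endsAboveMin n
    ; injective₁ = λ _ _ → prependMin-injective
    ; injective₂ = λ _ _ → appendMin-injective
    ; disjoint   = disjoint
    ; cover      = cover
    }
    where
    disjoint : ∀ {x y} → x ∈ Avoiders τ n → y ∈ Avoiders τ n → prependMin x ≢ appendMin y
    disjoint _ y∈ with _ , _ , refl ← IsPerm-nonempty 1≤n (proj₁ (Avoiders-∈⁻ τ n y∈)) = λ ()

  count-step : ∀ k → count τ (suc n) k ≡ count τ n k + countᵇ (λ ρ → suc (lis ρ) ≡ᵇ k) (Avoiders τ n)
  count-step k = trans (count-decompose τ n decomposition k) (trans (cong₂ _+_
    (countᵇ-cong (Avoiders τ n) λ {ρ} _ → cong (_≡ᵇ k) (lis-prependMin ρ))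
    (trans (countᵇ-cong (Avoiders τ n) λ ρ∈ → cong (_≡ᵇ k) (lis-appendMin-∈ 1≤n ρ∈)) (sym (count≡countᵇ-Avoiders τ n k))))
    (+-comm (countᵇ (λ ρ → suc (lis ρ) ≡ᵇ k) (Avoiders τ n)) (count τ n k)))

  recurrence : (count τ (suc n) 0 ≡ count τ n 0) × (∀ k → count τ (suc n) (suc k) ≡ count τ n (suc k) + count τ n k)
  recurrence = pascal-step τ n count-step

insertBefore : ℕ → ℕ → List ℕ → List ℕ
insertBefore v w []      = []
insertBefore v w (a ∷ r) = if a ≡ᵇ w then v ∷ a ∷ r else a ∷ insertBefore v w r

insertBefore-split : ∀ γ {v w δ} → w ∉ γ → insertBefore v w (γ ++ w ∷ δ) ≡ γ ++ v ∷ w ∷ δ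
insertBefore-split []      {w = w} _  rewrite ≡ᵇ-refl w = refl
insertBefore-split (a ∷ γ) {w = w} w∉ rewrite ≢⇒≡ᵇ≡false {a} {w} (w∉ ∘ here ∘ sym) =
  cong (a ∷_) (insertBefore-split γ (w∉ ∘ there))

last0 : List ℕ → ℕ
last0 []          = 0
last0 (a ∷ [])    = a
last0 (a ∷ b ∷ r) = last0 (b ∷ r)

last0-++ : ∀ xs {y : ℕ} {ys} → last0 (xs ++ y ∷ ys) ≡ last0 (y ∷ ys)
last0-++ []           = refl
last0-++ (a ∷ [])     = refl
last0-++ (a ∷ b ∷ xs) = last0-++ (b ∷ xs)

last0-∈ : ∀ y ys → last0 (y ∷ ys) ∈ y ∷ ys
last0-∈ y []       = here refl
last0-∈ y (b ∷ ys) = there (last0-∈ b ys)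

-- In a 231- and 312-avoider of [n+1] the maximum n is last or immediately followed by
-- m = n - 1: if m came before n, the two would start a 231 with the entry y after n, and if
-- m came after y, then n y m would be a 312.
module Avoiders231 (m : ℕ) where

  open Extensions 2 3 1

  n : ℕ
  n = suc m

  endsBelowMax : EndsBelowMax τ
  endsBelowMax {n} x y x<n _ m = <⇒≱ x<n (proj₁ (proj₂ (matches-231⁻ x y n m)))

  record SplitAtMax (ρ : List ℕ) : Set where
    constructor splitAtMax
    field
      γ δ : List ℕ
      ρ≡  : ρ ≡ γ ++ m ∷ δ
      m∉γ : m ∉ γ

  splitAt-m : ∀ {ρ} → IsPerm n ρ → SplitAtMax ρ
  splitAt-m isPerm@(_ , u , _) with ∈-∃++ (IsPerm⇒∈ isPerm ≤-refl)
  ... | γ , δ , refl = splitAtMax γ δ refl (Unique-∉ˡ γ u)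

  insertBefore-∈ : ∀ {ρ} → ρ ∈ Avoiders τ n → insertBefore n m ρ ∈ Avoiders τ (suc n)
  insertBefore-∈ ρ∈ with Avoiders-∈⁻ τ n ρ∈
  ... | isPerm@(_ , _ , ρ<n) , av₁ , av₂ with splitAt-m isPerm
  ... | splitAtMax γ δ refl m∉γ = subst (_∈ Avoiders τ (suc n)) (sym (insertBefore-split γ m∉γ))
    (Avoiders-∈⁺ τ (suc n) (IsPerm-insertMax γ (m ∷ δ) isPerm ,
      avoids-insert γ n (m ∷ δ) 3 1 2 av₁ no312First no312Second no312Third ,
      avoids-insert γ n (m ∷ δ) 2 3 1 av₂ no231First no231Second no231Third))
    where
    <n : ∀ {x} → x ∈ γ ++ m ∷ δ → x < n
    <n = All.lookup ρ<n
    no312First : ∀ y z → (y ∷ z ∷ []) ⊑ m ∷ δ → matches p312 n y z ≡ true → ⊥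
    no312First y z (keep q) occ = <⇒≱ (<n (∈-++⁺ʳ γ (there (⊑-∈ q (here refl))))) (proj₂ (proj₂ (matches-312⁻ n m z occ)))
    no312First y z (skip q) occ with y≤m , z≤m , y<z ← matches-312⁻ n y z occ =
      avoids⁻ p312 (⊑-++ˡ γ (keep q)) av₁
        (matches-312⁺ m y z (s≤s⁻¹ (<n (∈-++⁺ʳ γ (there (proj₁ (⊑-pair⇒∈ q))))))
                            (s≤s⁻¹ (<n (∈-++⁺ʳ γ (there (proj₂ (⊑-pair⇒∈ q)))))) y<z)
    no312Second : ∀ x z → x ∈ γ → z ∈ m ∷ δ → matches p312 x n z ≡ true → ⊥
    no312Second x z x∈ _ occ = <⇒≱ (<n (∈-++⁺ˡ x∈)) (proj₁ (matches-312⁻ x n z occ))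
    no312Third : ∀ x y → (x ∷ y ∷ []) ⊑ γ → matches p312 x y n ≡ true → ⊥
    no312Third x y p occ = <⇒≱ (<n (∈-++⁺ˡ (proj₁ (⊑-pair⇒∈ p)))) (proj₁ (proj₂ (matches-312⁻ x y n occ)))
    no231First : ∀ y z → (y ∷ z ∷ []) ⊑ m ∷ δ → matches p231 n y z ≡ true → ⊥
    no231First y z p occ = <⇒≱ (<n (∈-++⁺ʳ γ (proj₁ (⊑-pair⇒∈ p)))) (<⇒≤ (proj₁ (matches-231⁻ n y z occ)))
    no231Second : ∀ x z → x ∈ γ → z ∈ m ∷ δ → matches p231 x n z ≡ true → ⊥
    no231Second x z x∈ (here refl) occ =
      m∉γ (subst (_∈ γ) (≤-antisym (s≤s⁻¹ (<n (∈-++⁺ˡ x∈))) (proj₁ (proj₂ (matches-231⁻ x n m occ)))) x∈)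
    no231Second x z x∈ (there z∈) occ = avoids⁻ p231 (⊑-++ (∈⇒⊑ x∈) (keep (∈⇒⊑ z∈))) av₂
      (matches-231⁺ x m z (≤∧≢⇒< (s≤s⁻¹ (<n (∈-++⁺ˡ x∈))) (λ x≡m → m∉γ (subst (_∈ γ) x≡m x∈)))
                          (proj₁ (proj₂ (matches-231⁻ x n z occ))) (s≤s⁻¹ (<n (∈-++⁺ʳ γ (there z∈)))))
    no231Third : ∀ x y → (x ∷ y ∷ []) ⊑ γ → matches p231 x y n ≡ true → ⊥
    no231Third x y p occ = <⇒≱ (<n (∈-++⁺ˡ (proj₁ (⊑-pair⇒∈ p)))) (proj₁ (proj₂ (matches-231⁻ x y n occ)))

  insertBefore-injective : ∀ {x y} → x ∈ Avoiders τ n → y ∈ Avoiders τ n → insertBefore n m x ≡ insertBefore n m y → x ≡ y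
  insertBefore-injective x∈ y∈ e
    with isPermx@(_ , _ , x<n) , _ ← Avoiders-∈⁻ τ n x∈ with isPermy@(_ , _ , y<n) , _ ← Avoiders-∈⁻ τ n y∈
    with splitAtMax γ δ refl m∉γ ← splitAt-m isPermx with splitAtMax γ′ δ′ refl m∉γ′ ← splitAt-m isPermy
    with refl , refl ← ++-∷-cancel γ γ′ (All<⇒∉ γ x<n) (All<⇒∉ γ′ y<n)
                         (trans (sym (insertBefore-split γ m∉γ)) (trans e (insertBefore-split γ′ m∉γ′)))
    = refl

  appendMax≢insertBefore : ∀ {x y} → x ∈ Avoiders τ n → y ∈ Avoiders τ n → appendMax n x ≢ insertBefore n m y
  appendMax≢insertBefore {x} _ y∈ e with isPerm@(_ , _ , y<n) , _ ← Avoiders-∈⁻ τ n y∈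
                                    with splitAtMax γ δ refl m∉γ ← splitAt-m isPerm =
    <-irrefl lastIsN (All.lookup y<n (∈-++⁺ʳ γ (last0-∈ m δ)))
    where
    lastIsN : last0 (m ∷ δ) ≡ n
    lastIsN = begin
      last0 (m ∷ δ)               ≡⟨ sym (last0-++ (γ ++ [ n ])) ⟩
      last0 ((γ ++ [ n ]) ++ m ∷ δ) ≡⟨ cong last0 (++-assoc γ [ n ] (m ∷ δ)) ⟩
      last0 (γ ++ n ∷ m ∷ δ)       ≡⟨ cong last0 (sym (trans e (insertBefore-split γ m∉γ))) ⟩
      last0 (x ++ [ n ])           ≡⟨ last0-++ x ⟩
      n                            ∎
      where open ≡-Reasoning

  cover : ∀ {σ} → σ ∈ Avoiders τ (suc n) →
    (Σ (List ℕ) λ ρ → ρ ∈ Avoiders τ n × σ ≡ appendMax n ρ) ⊎ (Σ (List ℕ) λ ρ → ρ ∈ Avoiders τ n × σ ≡ insertBefore n m ρ)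
  cover {σ} σ∈ with Avoiders-∈⁻ τ (suc n) σ∈
  ... | isPerm@(_ , u , σ≤n) , av₁ , av₂ with ∈-∃++ (IsPerm⇒∈ isPerm ≤-refl)
  ... | γ , []    , refl = inj₁ (γ , appendMax⁻¹-∈ n γ σ∈ , refl)
  ... | γ , y ∷ δ , refl = inj₂ (γ ++ m ∷ δ , sublist-∈ isPermρ ρ⊑σ σ∈ ,
                                 sym (trans (insertBefore-split γ (Unique-∉ˡ γ (proj₁ (proj₂ isPermρ)))) (cong (λ t → γ ++ n ∷ t ∷ δ) (sym y≡m))))
    where
    y<n : y < n
    y<n = ≤∧≢⇒< (s≤s⁻¹ (All.lookup σ≤n (∈-++⁺ʳ γ (there (here refl))))) (λ y≡n → Unique-∉ʳ γ u (here (sym y≡n)))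
    y≡m : y ≡ m
    y≡m with ∈-++⁻ γ (IsPerm⇒∈ isPerm (m≤n⇒m≤1+n ≤-refl))
    ... | inj₂ (here m≡n)          = ⊥-elim (<-irrefl m≡n ≤-refl)
    ... | inj₂ (there (here m≡y))  = sym m≡y
    ... | inj₁ m∈γ                = ⊥-elim (avoids⁻ p231 (⊑-++ (∈⇒⊑ m∈γ) (keep (keep done))) av₂
                                      (matches-231⁺ m n y ≤-refl (s≤s⁻¹ y<n) (<⇒≤ y<n)))
    ... | inj₂ (there (there m∈δ)) = ⊥-elim (avoids⁻ p312 (⊑-++ˡ γ (keep (keep (∈⇒⊑ m∈δ)))) av₁
                                      (matches-312⁺ n y m (<⇒≤ y<n) (m≤n⇒m≤1+n ≤-refl) (≤∧≢⇒< (s≤s⁻¹ y<n) y≢m)))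
      where
      y≢m : y ≢ m
      y≢m refl = All.lookup (Unique-head (Unique-++⁻ʳ (γ ++ [ n ]) (subst Unique (sym (++-assoc γ [ n ] (y ∷ δ))) u))) m∈δ refl
    isPermρ : IsPerm n (γ ++ m ∷ δ)
    isPermρ = subst (λ t → IsPerm n (γ ++ t ∷ δ)) y≡m (IsPerm-deleteMax γ (y ∷ δ) isPerm)
    ρ⊑σ : γ ++ m ∷ δ ⊑ γ ++ n ∷ y ∷ δ
    ρ⊑σ = subst (λ t → γ ++ t ∷ δ ⊑ γ ++ n ∷ y ∷ δ) y≡m (⊑-insert γ n (⊑-refl (γ ++ y ∷ δ)))

  decomposition : Decomposition (Avoiders τ (suc n)) (Avoiders τ n) (Avoiders τ n) (appendMax n) (insertBefore n m)
  decomposition = record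
    { image₁     = appendMax-∈ endsBelowMax n
    ; image₂     = insertBefore-∈
    ; injective₁ = λ _ _ → appendMax-injective
    ; injective₂ = insertBefore-injective
    ; disjoint   = appendMax≢insertBefore
    ; cover      = cover
    }

  lis-insertBefore-∈ : ∀ {ρ} → ρ ∈ Avoiders τ n → lis (insertBefore n m ρ) ≡ lis ρ
  lis-insertBefore-∈ ρ∈ with isPerm@(_ , _ , ρ<n) , _ ← Avoiders-∈⁻ τ n ρ∈
                        with splitAtMax γ δ refl m∉γ ← splitAt-m isPerm
    = trans (cong lis (insertBefore-split γ m∉γ)) (lis-insertBefore γ δ ρ<n m∉γ)

  count-step : ∀ k → count τ (suc n) k ≡ count τ n k + countᵇ (λ ρ → suc (lis ρ) ≡ᵇ k) (Avoiders τ n)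
  count-step k = trans (count-decompose τ n decomposition k) (trans (cong₂ _+_
    (countᵇ-cong (Avoiders τ n) λ ρ∈ → cong (_≡ᵇ k) (lis-appendMax-∈ n ρ∈))
    (trans (countᵇ-cong (Avoiders τ n) λ ρ∈ → cong (_≡ᵇ k) (lis-insertBefore-∈ ρ∈)) (sym (count≡countᵇ-Avoiders τ n k))))
    (+-comm (countᵇ (λ ρ → suc (lis ρ) ≡ᵇ k) (Avoiders τ n)) (count τ n k)))

  recurrence : (count τ (suc n) 0 ≡ count τ n 0) × (∀ k → count τ (suc n) (suc k) ≡ count τ n (suc k) + count τ n k)
  recurrence = pascal-step τ n count-step

insertPenultimate : ℕ → List ℕ → List ℕ
insertPenultimate v []          = [ v ]
insertPenultimate v (a ∷ [])    = v ∷ a ∷ []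
insertPenultimate v (a ∷ b ∷ r) = a ∷ insertPenultimate v (b ∷ r)

dropLast : List ℕ → List ℕ
dropLast []          = []
dropLast (a ∷ [])    = []
dropLast (a ∷ b ∷ r) = a ∷ dropLast (b ∷ r)

insertPenultimate-∷ʳ : ∀ γ {v x} → insertPenultimate v (γ ++ [ x ]) ≡ γ ++ v ∷ [ x ]
insertPenultimate-∷ʳ []          = refl
insertPenultimate-∷ʳ (a ∷ [])    = refl
insertPenultimate-∷ʳ (a ∷ b ∷ γ) = cong (a ∷_) (insertPenultimate-∷ʳ (b ∷ γ))

dropLast-∷ʳ : ∀ γ {x} → dropLast (γ ++ [ x ]) ≡ γ
dropLast-∷ʳ []          = refl
dropLast-∷ʳ (a ∷ [])    = refl
dropLast-∷ʳ (a ∷ b ∷ γ) = cong (a ∷_) (dropLast-∷ʳ (b ∷ γ))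

countDropLast : List ℕ → ℕ → ℕ → ℕ
countDropLast τ n k = countᵇ (λ σ → lis (dropLast σ) ≡ᵇ k) (Avoiders τ n)

-- In a 321- and 312-avoider the maximum n is last or second to last: two later entries
-- y, z would make n y z a 312 (y < z) or a 321 (y > z).  Inserting n second to last raises
-- the length of the longest increasing subsequence of the permutation without its last
-- entry, which is why that statistic is counted alongside.
module Avoiders321 (n : ℕ) (1≤n : 1 ≤ n) where

  open Extensions 3 2 1

  endsBelowMax : EndsBelowMax τ
  endsBelowMax {n} x y x<n _ m = <⇒≱ x<n (proj₁ (proj₂ (matches-321⁻ x y n m)))

  snoc-∈ : ∀ {ρ} → ρ ∈ Avoiders τ n → Σ (List ℕ) λ γ → Σ ℕ λ x → ρ ≡ γ ++ [ x ]
  snoc-∈ ρ∈ with a , r , refl ← IsPerm-nonempty 1≤n (proj₁ (Avoiders-∈⁻ τ n ρ∈)) = snocView (a ∷ r) refl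

  no-pair-after : ∀ {y z x : ℕ} → (y ∷ z ∷ []) ⊑ [ x ] → ⊥
  no-pair-after (skip ())
  no-pair-after (keep ())

  insertPenultimate-∈ : ∀ {ρ} → ρ ∈ Avoiders τ n → insertPenultimate n ρ ∈ Avoiders τ (suc n)
  insertPenultimate-∈ ρ∈ with Avoiders-∈⁻ τ n ρ∈ | snoc-∈ ρ∈
  ... | isPerm@(_ , _ , ρ<n) , av₁ , av₂ | γ , x , refl rewrite insertPenultimate-∷ʳ γ {n} {x} =
    Avoiders-∈⁺ τ (suc n) (IsPerm-insertMax γ [ x ] isPerm ,
      avoids-insert γ n [ x ] 3 1 2 av₁ (λ _ _ p _ → no-pair-after p)
        (λ x z x∈ _ occ → <⇒≱ (γ<n x∈) (proj₁ (matches-312⁻ x n z occ)))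
        (λ x y p occ → <⇒≱ (γ<n (proj₁ (⊑-pair⇒∈ p))) (proj₁ (proj₂ (matches-312⁻ x y n occ)))) ,
      avoids-insert γ n [ x ] 3 2 1 av₂ (λ _ _ p _ → no-pair-after p)
        (λ x z x∈ _ occ → <⇒≱ (γ<n x∈) (proj₁ (matches-321⁻ x n z occ)))
        (λ x y p occ → <⇒≱ (γ<n (proj₁ (⊑-pair⇒∈ p))) (proj₁ (proj₂ (matches-321⁻ x y n occ)))))
    where
    γ<n : ∀ {x} → x ∈ γ → x < n
    γ<n x∈ = All.lookup ρ<n (∈-++⁺ˡ x∈)

  insertPenultimate-injective : ∀ {x y} → x ∈ Avoiders τ n → y ∈ Avoiders τ n →
                                insertPenultimate n x ≡ insertPenultimate n y → x ≡ y
  insertPenultimate-injective x∈ y∈ e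
    with (_ , _ , x<n) , _ ← Avoiders-∈⁻ τ n x∈ with (_ , _ , y<n) , _ ← Avoiders-∈⁻ τ n y∈
    with γ , _ , refl ← snoc-∈ x∈ with γ′ , _ , refl ← snoc-∈ y∈
    with refl , refl ← ++-∷-cancel γ γ′ (All<⇒∉ γ x<n) (All<⇒∉ γ′ y<n)
                         (trans (sym (insertPenultimate-∷ʳ γ)) (trans e (insertPenultimate-∷ʳ γ′)))
    = refl

  appendMax≢insertPenultimate : ∀ {x y} → x ∈ Avoiders τ n → y ∈ Avoiders τ n → appendMax n x ≢ insertPenultimate n y
  appendMax≢insertPenultimate {x} _ y∈ e with (_ , _ , y<n) , _ ← Avoiders-∈⁻ τ n y∈ | snoc-∈ y∈
  ... | γ , z , refl = <-irrefl (sym n≡z) (All.lookup y<n (∈-++⁺ʳ γ (here refl)))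
    where
    n≡z : n ≡ z
    n≡z = ∷ʳ-injectiveʳ x (γ ++ [ n ]) (trans e (trans (insertPenultimate-∷ʳ γ) (sym (++-assoc γ [ n ] [ z ]))))

  cover : ∀ {σ} → σ ∈ Avoiders τ (suc n) →
    (Σ (List ℕ) λ ρ → ρ ∈ Avoiders τ n × σ ≡ appendMax n ρ) ⊎ (Σ (List ℕ) λ ρ → ρ ∈ Avoiders τ n × σ ≡ insertPenultimate n ρ)
  cover {σ} σ∈ with Avoiders-∈⁻ τ (suc n) σ∈
  ... | isPerm@(_ , u , σ≤n) , av₁ , av₂ with ∈-∃++ (IsPerm⇒∈ isPerm ≤-refl)
  ... | γ , []        , refl = inj₁ (γ , appendMax⁻¹-∈ n γ σ∈ , refl)
  ... | γ , x ∷ []    , refl = inj₂ (γ ++ [ x ] ,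
          sublist-∈ (IsPerm-deleteMax γ [ x ] isPerm) (⊑-insert γ n (⊑-refl (γ ++ [ x ]))) σ∈ ,
          sym (insertPenultimate-∷ʳ γ))
  ... | γ , y ∷ z ∷ δ , refl with <-cmp y z
  ...   | tri< y<z _ _ = ⊥-elim (avoids⁻ p312 occurrence av₁ (matches-312⁺ n y z y≤max z≤max y<z))
    where
    occurrence = ⊑-++ˡ γ (keep (keep (keep done)))
    y≤max = s≤s⁻¹ (All.lookup σ≤n (∈-++⁺ʳ γ (there (here refl))))
    z≤max = s≤s⁻¹ (All.lookup σ≤n (∈-++⁺ʳ γ (there (there (here refl)))))
  ...   | tri≈ _ y≡z _ = ⊥-elim (Unique-∉ʳ (γ ++ [ n ]) u′ (here y≡z))
    where
    u′ = subst Unique (sym (++-assoc γ [ n ] (y ∷ z ∷ δ))) u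
  ...   | tri> _ _ z<y = ⊥-elim (avoids⁻ p321 occurrence av₂ (matches-321⁺ n y z y≤max z≤max (<⇒≤ z<y)))
    where
    occurrence = ⊑-++ˡ γ (keep (keep (keep done)))
    y≤max = s≤s⁻¹ (All.lookup σ≤n (∈-++⁺ʳ γ (there (here refl))))
    z≤max = s≤s⁻¹ (All.lookup σ≤n (∈-++⁺ʳ γ (there (there (here refl)))))

  decomposition : Decomposition (Avoiders τ (suc n)) (Avoiders τ n) (Avoiders τ n) (appendMax n) (insertPenultimate n)
  decomposition = record
    { image₁     = appendMax-∈ endsBelowMax n
    ; image₂     = insertPenultimate-∈
    ; injective₁ = λ _ _ → appendMax-injective
    ; injective₂ = insertPenultimate-injective
    ; disjoint   = appendMax≢insertPenultimate
    ; cover      = cover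
    }

  split : ∀ p → countᵇ p (Avoiders τ (suc n)) ≡
                countᵇ (p ∘ appendMax n) (Avoiders τ n) + countᵇ (p ∘ insertPenultimate n) (Avoiders τ n)
  split = countᵇ-decompose (Avoiders-Unique τ (suc n)) (Avoiders-Unique τ n) (Avoiders-Unique τ n) decomposition

  lis-insertPenultimate-∈ : ∀ {ρ} → ρ ∈ Avoiders τ n → lis (insertPenultimate n ρ) ≡ suc (lis (dropLast ρ))
  lis-insertPenultimate-∈ ρ∈ with (_ , _ , ρ<n) , _ ← Avoiders-∈⁻ τ n ρ∈ | snoc-∈ ρ∈
  ... | γ , x , refl rewrite insertPenultimate-∷ʳ γ {n} {x} | dropLast-∷ʳ γ {x} = lis-insertPenultimate γ x ρ<n

  lis-dropLast-insertPenultimate-∈ : ∀ {ρ} → ρ ∈ Avoiders τ n → lis (dropLast (insertPenultimate n ρ)) ≡ suc (lis (dropLast ρ))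
  lis-dropLast-insertPenultimate-∈ ρ∈ with (_ , _ , ρ<n) , _ ← Avoiders-∈⁻ τ n ρ∈ | snoc-∈ ρ∈
  ... | γ , x , refl rewrite insertPenultimate-∷ʳ γ {n} {x} | dropLast-∷ʳ γ {x} =
    trans (cong (lis ∘ dropLast) (sym (++-assoc γ [ n ] [ x ])))
          (trans (cong lis (dropLast-∷ʳ (γ ++ [ n ]))) (lis-appendMax (Allₚ.++⁻ˡ γ ρ<n)))

  count-step : ∀ k → count τ (suc n) k ≡
    countᵇ (λ ρ → suc (lis ρ) ≡ᵇ k) (Avoiders τ n) + countᵇ (λ ρ → suc (lis (dropLast ρ)) ≡ᵇ k) (Avoiders τ n)
  count-step k = trans (count≡countᵇ-Avoiders τ (suc n) k) (trans (split (λ σ → lis σ ≡ᵇ k)) (cong₂ _+_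
    (countᵇ-cong (Avoiders τ n) λ ρ∈ → cong (_≡ᵇ k) (lis-appendMax-∈ n ρ∈))
    (countᵇ-cong (Avoiders τ n) λ ρ∈ → cong (_≡ᵇ k) (lis-insertPenultimate-∈ ρ∈))))

  countDropLast-step : ∀ k → countDropLast τ (suc n) k ≡
    count τ n k + countᵇ (λ ρ → suc (lis (dropLast ρ)) ≡ᵇ k) (Avoiders τ n)
  countDropLast-step k = trans (split (λ σ → lis (dropLast σ) ≡ᵇ k)) (cong₂ _+_
    (trans (countᵇ-cong (Avoiders τ n) λ {ρ} _ → cong (λ σ → lis σ ≡ᵇ k) (dropLast-∷ʳ ρ)) (sym (count≡countᵇ-Avoiders τ n k)))
    (countᵇ-cong (Avoiders τ n) λ ρ∈ → cong (_≡ᵇ k) (lis-dropLast-insertPenultimate-∈ ρ∈)))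

  count-zero : count τ (suc n) 0 ≡ 0
  count-zero = trans (count-step 0) (cong₂ _+_ (countᵇ-none (Avoiders τ n) (λ _ → refl)) (countᵇ-none (Avoiders τ n) (λ _ → refl)))

  count-suc : ∀ k → count τ (suc n) (suc k) ≡ count τ n k + countDropLast τ n k
  count-suc k = trans (count-step (suc k)) (cong (_+ countDropLast τ n k) (sym (count≡countᵇ-Avoiders τ n k)))

  countDropLast-zero : countDropLast τ (suc n) 0 ≡ count τ n 0
  countDropLast-zero = trans (countDropLast-step 0) (trans (cong (count τ n 0 +_) (countᵇ-none (Avoiders τ n) (λ _ → refl))) (+-identityʳ _))

  countDropLast-suc : ∀ k → countDropLast τ (suc n) (suc k) ≡ count τ n (suc k) + countDropLast τ n k
  countDropLast-suc k = countDropLast-step (suc k)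

insertAfterZero : ℕ → List ℕ → List ℕ
insertAfterZero v []      = []
insertAfterZero v (a ∷ r) = if a ≡ᵇ 0 then a ∷ v ∷ r else a ∷ insertAfterZero v r

insertAfterZero-split : ∀ α {v β} → 0 ∉ α → insertAfterZero v (α ++ 0 ∷ β) ≡ α ++ 0 ∷ v ∷ β
insertAfterZero-split []      _  = refl
insertAfterZero-split (a ∷ α) 0∉ rewrite ≢⇒≡ᵇ≡false {a} {0} (0∉ ∘ here ∘ sym) =
  cong (a ∷_) (insertAfterZero-split α (0∉ ∘ there))

lastNonzero : List ℕ → Bool
lastNonzero σ = not (last0 σ ≡ᵇ 0)

lastNonzero⇒≢0 : ∀ σ → lastNonzero σ ≡ true → last0 σ ≢ 0
lastNonzero⇒≢0 σ nz last≡0 rewrite last≡0 with () ← nz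

-- A 123- and 312-avoider either ends with 0, which can be deleted without changing the
-- longest increasing subsequences, or it ends with an entry above the earlier 0, and then
-- those subsequences have length exactly 2.  In the latter case the maximum n comes right
-- after 0 (deleting it leaves a permutation of the same kind) or last, after a decreasing
-- sequence.
module Avoiders123 (n : ℕ) (1≤n : 1 ≤ n) where

  open Extensions 1 2 3

  endsAboveMin : EndsAboveMin τ
  endsAboveMin x y m = n≮0 (proj₂ (proj₂ (matches-123⁻ x y 0 m)))

  NonzeroLast Decreasing : ℕ → LL
  NonzeroLast m = filterᵇ lastNonzero (Avoiders τ m)
  Decreasing  m = filterᵇ (λ ρ → lis ρ ≡ᵇ 1) (Avoiders τ m)

  NonzeroLast-∈⁻ : ∀ m {σ} → σ ∈ NonzeroLast m → σ ∈ Avoiders τ m × lastNonzero σ ≡ true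
  NonzeroLast-∈⁻ m = ∈-filterᵇ⁻ {lastNonzero} {Avoiders τ m}

  NonzeroLast-∈⁺ : ∀ m {σ} → σ ∈ Avoiders τ m → lastNonzero σ ≡ true → σ ∈ NonzeroLast m
  NonzeroLast-∈⁺ m = ∈-filterᵇ⁺ {lastNonzero} {Avoiders τ m}

  Decreasing-∈⁻ : ∀ m {σ} → σ ∈ Decreasing m → σ ∈ Avoiders τ m × (lis σ ≡ᵇ 1) ≡ true
  Decreasing-∈⁻ m = ∈-filterᵇ⁻ {λ ρ → lis ρ ≡ᵇ 1} {Avoiders τ m}

  Decreasing-∈⁺ : ∀ m {σ} → σ ∈ Avoiders τ m → (lis σ ≡ᵇ 1) ≡ true → σ ∈ Decreasing m
  Decreasing-∈⁺ m = ∈-filterᵇ⁺ {λ ρ → lis ρ ≡ᵇ 1} {Avoiders τ m}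

  NonzeroLast-Unique : ∀ m → Unique (NonzeroLast m)
  NonzeroLast-Unique m = UP.filter⁺ (T? ∘ lastNonzero) (Avoiders-Unique τ m)

  Decreasing-Unique : ∀ m → Unique (Decreasing m)
  Decreasing-Unique m = UP.filter⁺ (λ ρ → T? (lis ρ ≡ᵇ 1)) (Avoiders-Unique τ m)

  appendMin≢nonzeroLast : ∀ {x y} → x ∈ Avoiders τ n → y ∈ NonzeroLast (suc n) → appendMin x ≢ y
  appendMin≢nonzeroLast {x} _ y∈ refl = lastNonzero⇒≢0 (appendMin x) (proj₂ (NonzeroLast-∈⁻ (suc n) y∈)) (last0-++ (map suc x))

  coverZeroLast : ∀ {σ} → σ ∈ Avoiders τ (suc n) →
    (Σ (List ℕ) λ ρ → ρ ∈ Avoiders τ n × σ ≡ appendMin ρ) ⊎ (Σ (List ℕ) λ ρ → ρ ∈ NonzeroLast (suc n) × σ ≡ ρ)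
  coverZeroLast {σ} σ∈ with lastNonzero σ in nz
  ... | true  = inj₂ (σ , NonzeroLast-∈⁺ (suc n) σ∈ nz , refl)
  ... | false with (length≡ , _) , _ ← Avoiders-∈⁻ τ (suc n) σ∈
              with γ , x , refl ← snocView σ length≡
              with x ≟ 0
  ...   | yes refl = inj₁ (appendMin⁻¹-∈ n γ σ∈)
  ...   | no x≢0   rewrite last0-++ γ {x} {[]} | ≢⇒≡ᵇ≡false x≢0 with () ← nz

  zeroLast : Decomposition (Avoiders τ (suc n)) (Avoiders τ n) (NonzeroLast (suc n)) appendMin (λ σ → σ)
  zeroLast = record
    { image₁     = appendMin-∈ endsAboveMin n
    ; image₂     = proj₁ ∘ NonzeroLast-∈⁻ (suc n)
    ; injective₁ = λ _ _ → appendMin-injective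
    ; injective₂ = λ _ _ e → e
    ; disjoint   = appendMin≢nonzeroLast
    ; cover      = coverZeroLast
    }

  record ZeroFollowed (ρ : List ℕ) : Set where
    constructor zeroFollowed
    field
      α : List ℕ
      w : ℕ
      β : List ℕ
      ρ≡  : ρ ≡ α ++ 0 ∷ w ∷ β
      0∉α : 0 ∉ α

  zeroFollowed-∈ : ∀ {ρ} → ρ ∈ NonzeroLast n → ZeroFollowed ρ
  zeroFollowed-∈ ρ∈ with ρ∈′ , nz ← NonzeroLast-∈⁻ n ρ∈ with isPerm@(_ , u , _) , _ ← Avoiders-∈⁻ τ n ρ∈′
                    with ∈-∃++ (IsPerm⇒∈ isPerm 1≤n)
  ... | α , []    , refl = ⊥-elim (lastNonzero⇒≢0 (α ++ [ 0 ]) nz (last0-++ α))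
  ... | α , w ∷ β , refl = zeroFollowed α w β refl (Unique-∉ˡ α u)

  insertAfterZero-∈ : ∀ {ρ} → ρ ∈ NonzeroLast n → insertAfterZero n ρ ∈ NonzeroLast (suc n)
  insertAfterZero-∈ ρ∈ with ρ∈′ , nz ← NonzeroLast-∈⁻ n ρ∈ with isPerm@(_ , u , ρ<n) , av₁ , av₂ ← Avoiders-∈⁻ τ n ρ∈′
                       with zeroFollowed α w β refl 0∉α ← zeroFollowed-∈ ρ∈
    rewrite insertAfterZero-split α {n} {w ∷ β} 0∉α =
    NonzeroLast-∈⁺ (suc n) (Avoiders-∈⁺ τ (suc n) (isPermσ , av312 , av123))
      (trans (cong (not ∘ (_≡ᵇ 0)) (trans (last0-++ α {0} {n ∷ w ∷ β}) (sym (last0-++ α {0} {w ∷ β})))) nz)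
    where
    α0 = α ++ [ 0 ]
    α0++ : ∀ {t : ℕ} ys → α0 ++ t ∷ ys ≡ α ++ 0 ∷ t ∷ ys
    α0++ {t} ys = ++-assoc α [ 0 ] (t ∷ ys)
    ρ≡ : α0 ++ w ∷ β ≡ α ++ 0 ∷ w ∷ β
    ρ≡ = α0++ β
    isPermσ : IsPerm (suc n) (α ++ 0 ∷ n ∷ w ∷ β)
    isPermσ = subst (IsPerm (suc n)) (α0++ (w ∷ β)) (IsPerm-insertMax α0 (w ∷ β) (subst (IsPerm n) (sym ρ≡) isPerm))
    α0<n : ∀ {x} → x ∈ α0 → x < n
    α0<n x∈ = All.lookup ρ<n (subst (_ ∈_) ρ≡ (∈-++⁺ˡ x∈))
    after<n : ∀ {x} → x ∈ w ∷ β → x < n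
    after<n x∈ = All.lookup ρ<n (∈-++⁺ʳ α (there x∈))
    after>0 : ∀ {y} → y ∈ w ∷ β → 0 < y
    after>0 {zero}  y∈ = ⊥-elim (Unique-∉ʳ α u y∈)
    after>0 {suc y} _  = z<s
    av312 : avoids (α ++ 0 ∷ n ∷ w ∷ β) p312 ≡ true
    av312 = subst (λ σ → avoids σ p312 ≡ true) (α0++ (w ∷ β))
      (avoids-insert α0 n (w ∷ β) 3 1 2 (subst (λ σ → avoids σ p312 ≡ true) (sym ρ≡) av₁)
        (λ y z p occ → avoids⁻ p123 (⊑-++ˡ α (keep p)) av₂
           (matches-123⁺ 0 y z (after>0 (proj₁ (⊑-pair⇒∈ p))) (after>0 (proj₂ (⊑-pair⇒∈ p))) (proj₂ (proj₂ (matches-312⁻ n y z occ)))))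
        (λ x z x∈ _ occ → <⇒≱ (α0<n x∈) (proj₁ (matches-312⁻ x n z occ)))
        (λ x y p occ → <⇒≱ (α0<n (proj₁ (⊑-pair⇒∈ p))) (proj₁ (proj₂ (matches-312⁻ x y n occ)))))
    no123Third : ∀ x y → (x ∷ y ∷ []) ⊑ α0 → matches p123 x y n ≡ true → ⊥
    no123Third x y p occ with pairSplit α 0 [] p | matches-123⁻ x y n occ
    ... | first _ ()    | _
    ... | second refl _ | x<y , _ = n≮0 x<y
    ... | avoiding q    | x<y , _ with q′ ← subst ((x ∷ y ∷ []) ⊑_) (++-identityʳ α) q with <-cmp y w
    ...   | tri< y<w _ _ = avoids⁻ p123 (⊑-++ q′ (skip (keep done))) av₂ (matches-123⁺ x y w x<y (<-trans x<y y<w) y<w)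
    ...   | tri≈ _ y≡w _ = Unique-separates α u (proj₂ (⊑-pair⇒∈ q′)) (here refl) y≡w
    ...   | tri> _ _ w<y = avoids⁻ p312 (⊑-++ (∈⇒⊑ (proj₂ (⊑-pair⇒∈ q′))) (keep (keep done))) av₁
                             (matches-312⁺ y 0 w z≤n (<⇒≤ w<y) (after>0 (here refl)))
    av123 : avoids (α ++ 0 ∷ n ∷ w ∷ β) p123 ≡ true
    av123 = subst (λ σ → avoids σ p123 ≡ true) (α0++ (w ∷ β))
      (avoids-insert α0 n (w ∷ β) 1 2 3 (subst (λ σ → avoids σ p123 ≡ true) (sym ρ≡) av₂)
        (λ y z p occ → <⇒≱ (after<n (proj₁ (⊑-pair⇒∈ p))) (<⇒≤ (proj₁ (matches-123⁻ n y z occ))))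
        (λ x z _ z∈ occ → <⇒≱ (after<n z∈) (<⇒≤ (proj₂ (proj₂ (matches-123⁻ x n z occ)))))
        no123Third)

  appendMax-decreasing-∈ : ∀ {ρ} → ρ ∈ Decreasing n → appendMax n ρ ∈ NonzeroLast (suc n)
  appendMax-decreasing-∈ {ρ} ρ∈ with ρ∈′ , lis≡1 ← Decreasing-∈⁻ n ρ∈ with isPerm@(_ , _ , ρ<n) , av₁ , av₂ ← Avoiders-∈⁻ τ n ρ∈′ =
    NonzeroLast-∈⁺ (suc n) (Avoiders-∈⁺ τ (suc n) (IsPerm-appendMax isPerm ,
        avoids-appendMax 3 1 2 ρ<n endsBelowMax-312 av₁ ,
        avoids-insert ρ n [] 1 2 3 (subst (λ σ → avoids σ p123 ≡ true) (sym (++-identityʳ ρ)) av₂) (λ _ _ ()) (λ _ _ _ ()) no123))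
      (trans (cong (not ∘ (_≡ᵇ 0)) (last0-++ ρ)) (cong not (≢⇒≡ᵇ≡false (<⇒≢ 1≤n ∘ sym))))
    where
    no123 : ∀ x y → (x ∷ y ∷ []) ⊑ ρ → matches p123 x y n ≡ true → ⊥
    no123 x y p occ = <⇒≱ (s≤s ≤-refl) (subst (2 ≤_) (≡ᵇ≡true⇒≡ lis≡1) (lis≥2 p (proj₁ (matches-123⁻ x y n occ))))

  insertAfterZero-injective : ∀ {x y} → x ∈ NonzeroLast n → y ∈ NonzeroLast n →
                              insertAfterZero n x ≡ insertAfterZero n y → x ≡ y
  insertAfterZero-injective x∈ y∈ e
    with zeroFollowed α _ _ refl 0∉α ← zeroFollowed-∈ x∈ with zeroFollowed α′ _ _ refl 0∉α′ ← zeroFollowed-∈ y∈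
    with refl , refl ← ++-∷-cancel α α′ 0∉α 0∉α′
                         (trans (sym (insertAfterZero-split α 0∉α)) (trans e (insertAfterZero-split α′ 0∉α′)))
    = refl

  insertAfterZero≢appendMax : ∀ {x y} → x ∈ NonzeroLast n → y ∈ Decreasing n → insertAfterZero n x ≢ appendMax n y
  insertAfterZero≢appendMax {x} {y} x∈ _ e with zeroFollowed α w β refl 0∉α ← zeroFollowed-∈ x∈
                                           with (_ , _ , x<n) , _ ← Avoiders-∈⁻ τ n (proj₁ (NonzeroLast-∈⁻ n x∈)) =
    <-irrefl lastIsN (All.lookup x<n (∈-++⁺ʳ α (there (last0-∈ w β))))
    where
    lastIsN : last0 (w ∷ β) ≡ n
    lastIsN = trans (sym (last0-++ α {0} {n ∷ w ∷ β}))
                    (trans (cong last0 (trans (sym (insertAfterZero-split α 0∉α)) e)) (last0-++ y))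

  coverNewMaxAfterZero : ∀ α β → α ++ 0 ∷ n ∷ β ∈ NonzeroLast (suc n) →
    (Σ (List ℕ) λ ρ → ρ ∈ NonzeroLast n × α ++ 0 ∷ n ∷ β ≡ insertAfterZero n ρ) ⊎
    (Σ (List ℕ) λ ρ → ρ ∈ Decreasing n × α ++ 0 ∷ n ∷ β ≡ appendMax n ρ)
  coverNewMaxAfterZero α [] σ∈ with σ∈′ , _ ← NonzeroLast-∈⁻ (suc n) σ∈ with isPerm , _ , av₂ ← Avoiders-∈⁻ τ (suc n) σ∈′ =
    inj₂ (α ++ [ 0 ] , Decreasing-∈⁺ n (sublist-∈ isPermρ ρ⊑σ σ∈′) (T⇒≡ (≡⇒≡ᵇ _ _ lisρ≡1)) , sym (++-assoc α [ 0 ] [ n ]))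
    where
    isPermρ : IsPerm n (α ++ [ 0 ])
    isPermρ = subst (IsPerm n) (++-identityʳ _) (IsPerm-deleteMax (α ++ [ 0 ]) [] (subst (IsPerm (suc n)) (sym (++-assoc α [ 0 ] [ n ])) isPerm))
    ρ⊑σ : α ++ [ 0 ] ⊑ α ++ 0 ∷ n ∷ []
    ρ⊑σ = ⊑-++ (⊑-refl α) (keep done)
    lisρ≡1 : lis (α ++ [ 0 ]) ≡ 1
    lisρ≡1 = ≤-antisym (lis≤ noPair) (length≤lis (⊑-++ˡ α (keep done)) (increasing✓ refl))
      where
      noPair : ∀ s → s ⊑ α ++ [ 0 ] → Increasing s → length s ≤ 1
      noPair []          _ _   = z≤n
      noPair (_ ∷ [])    _ _   = s≤s z≤n
      noPair (x ∷ y ∷ _) q inc with xy⊑ ← ⊑-trans (keep (keep done)) q =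
        ⊥-elim (avoids⁻ p123 (subst ((x ∷ y ∷ n ∷ []) ⊑_) (++-assoc α [ 0 ] [ n ]) (⊑-++ xy⊑ (keep done))) av₂
          (matches-123⁺ x y n (inc-head inc) (All.lookup ρ<n (proj₁ (⊑-pair⇒∈ xy⊑))) (All.lookup ρ<n (proj₂ (⊑-pair⇒∈ xy⊑)))))
        where
        ρ<n = proj₂ (proj₂ isPermρ)
  coverNewMaxAfterZero α (w ∷ β) σ∈ with σ∈′ , nz ← NonzeroLast-∈⁻ (suc n) σ∈ with isPerm@(_ , u , _) , _ ← Avoiders-∈⁻ τ (suc n) σ∈′ =
    inj₁ (α ++ 0 ∷ w ∷ β , NonzeroLast-∈⁺ n (sublist-∈ isPermρ ρ⊑σ σ∈′) nonzero , sym (insertAfterZero-split α (Unique-∉ˡ α u)))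
    where
    isPermρ : IsPerm n (α ++ 0 ∷ w ∷ β)
    isPermρ = subst (IsPerm n) (++-assoc α [ 0 ] (w ∷ β))
                (IsPerm-deleteMax (α ++ [ 0 ]) (w ∷ β) (subst (IsPerm (suc n)) (sym (++-assoc α [ 0 ] (n ∷ w ∷ β))) isPerm))
    ρ⊑σ : α ++ 0 ∷ w ∷ β ⊑ α ++ 0 ∷ n ∷ w ∷ β
    ρ⊑σ = ⊑-++ (⊑-refl α) (keep (skip (⊑-refl (w ∷ β))))
    nonzero : lastNonzero (α ++ 0 ∷ w ∷ β) ≡ true
    nonzero = trans (cong (not ∘ (_≡ᵇ 0)) (trans (last0-++ α {0} {w ∷ β}) (sym (last0-++ α {0} {n ∷ w ∷ β})))) nz

  coverNonzeroLast : ∀ {σ} → σ ∈ NonzeroLast (suc n) →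
    (Σ (List ℕ) λ ρ → ρ ∈ NonzeroLast n × σ ≡ insertAfterZero n ρ) ⊎ (Σ (List ℕ) λ ρ → ρ ∈ Decreasing n × σ ≡ appendMax n ρ)
  coverNonzeroLast {σ} σ∈ with σ∈′ , nz ← NonzeroLast-∈⁻ (suc n) σ∈ with isPerm@(_ , u , σ≤n) , av₁ , av₂ ← Avoiders-∈⁻ τ (suc n) σ∈′
                          with ∈-∃++ (IsPerm⇒∈ isPerm z<s)
  ... | α , []    , refl = ⊥-elim (lastNonzero⇒≢0 (α ++ [ 0 ]) nz (last0-++ α))
  ... | α , b ∷ β , refl with ∈-++⁻ α (IsPerm⇒∈ isPerm ≤-refl)
  ...   | inj₁ n∈α = ⊥-elim (avoids⁻ p312 (⊑-++ (∈⇒⊑ n∈α) (keep (∈⇒⊑ (last0-∈ b β)))) av₁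
                       (matches-312⁺ n 0 (last0 (b ∷ β)) z≤n (s≤s⁻¹ (All.lookup σ≤n (∈-++⁺ʳ α (there (last0-∈ b β)))))
                                      (≤∧≢⇒< z≤n (λ 0≡last → lastNonzero⇒≢0 (α ++ 0 ∷ b ∷ β) nz (trans (last0-++ α) (sym 0≡last))))))
  ...   | inj₂ (here n≡0) = ⊥-elim (<⇒≢ 1≤n (sym n≡0))
  ...   | inj₂ (there (there n∈β)) = ⊥-elim (avoids⁻ p123 (⊑-++ˡ α (keep (keep (∈⇒⊑ n∈β)))) av₂
                       (matches-123⁺ 0 b n (≤∧≢⇒< z≤n (λ 0≡b → Unique-∉ʳ α u (here 0≡b))) 1≤n (≤∧≢⇒< b≤n b≢n)))
    where
    b≤n = s≤s⁻¹ (All.lookup σ≤n (∈-++⁺ʳ α (there (here refl))))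
    b≢n : b ≢ n
    b≢n b≡n = Unique-∉ʳ (α ++ [ 0 ]) (subst Unique (sym (++-assoc α [ 0 ] (b ∷ β))) u) (subst (_∈ β) (sym b≡n) n∈β)
  ...   | inj₂ (there (here refl)) = coverNewMaxAfterZero α β σ∈

  newMaximum : Decomposition (NonzeroLast (suc n)) (NonzeroLast n) (Decreasing n) (insertAfterZero n) (appendMax n)
  newMaximum = record
    { image₁     = insertAfterZero-∈
    ; image₂     = appendMax-decreasing-∈
    ; injective₁ = insertAfterZero-injective
    ; injective₂ = λ _ _ → appendMax-injective
    ; disjoint   = insertAfterZero≢appendMax
    ; cover      = coverNonzeroLast
    }

  lis-nonzeroLast : ∀ {σ} → σ ∈ NonzeroLast (suc n) → lis σ ≡ 2
  lis-nonzeroLast {σ} σ∈ with σ∈′ , nz ← NonzeroLast-∈⁻ (suc n) σ∈ with isPerm , _ , av₂ ← Avoiders-∈⁻ τ (suc n) σ∈′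
                         with ∈-∃++ (IsPerm⇒∈ isPerm z<s)
  ... | α , []    , refl = ⊥-elim (lastNonzero⇒≢0 (α ++ [ 0 ]) nz (last0-++ α))
  ... | α , b ∷ β , refl = ≤-antisym (avoids123⇒lis≤2 {α ++ 0 ∷ b ∷ β} av₂)
          (lis≥2 (⊑-++ˡ α (keep (∈⇒⊑ (last0-∈ b β)))) (≤∧≢⇒< z≤n (λ 0≡last → lastNonzero⇒≢0 (α ++ 0 ∷ b ∷ β) nz (trans (last0-++ α) (sym 0≡last)))))

  count-step : ∀ k → count τ (suc n) k ≡ count τ n k + countᵇ (λ _ → 2 ≡ᵇ k) (NonzeroLast (suc n))
  count-step k = trans (count≡countᵇ-Avoiders τ (suc n) k)
    (trans (countᵇ-decompose (Avoiders-Unique τ (suc n)) (Avoiders-Unique τ n) (NonzeroLast-Unique (suc n)) zeroLast (λ σ → lis σ ≡ᵇ k))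
      (cong₂ _+_ (trans (countᵇ-cong (Avoiders τ n) λ ρ∈ → cong (_≡ᵇ k) (lis-appendMin-∈ 1≤n ρ∈)) (sym (count≡countᵇ-Avoiders τ n k)))
                 (countᵇ-cong (NonzeroLast (suc n)) λ σ∈ → cong (_≡ᵇ k) (lis-nonzeroLast σ∈))))

  count-≢2 : ∀ k → (2 ≡ᵇ k) ≡ false → count τ (suc n) k ≡ count τ n k
  count-≢2 k 2≢k = trans (count-step k) (trans (cong (count τ n k +_) (countᵇ-none (NonzeroLast (suc n)) (λ _ → 2≢k))) (+-identityʳ _))

  count-2 : count τ (suc n) 2 ≡ count τ n 2 + length (NonzeroLast (suc n))
  count-2 = trans (count-step 2) (cong (count τ n 2 +_) (countᵇ-all (NonzeroLast (suc n))))

  nonzeroLast-step : length (NonzeroLast (suc n)) ≡ length (NonzeroLast n) + count τ n 1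
  nonzeroLast-step = begin
    length (NonzeroLast (suc n))                         ≡⟨ sym (countᵇ-all (NonzeroLast (suc n))) ⟩
    countᵇ (λ _ → true) (NonzeroLast (suc n))            ≡⟨ countᵇ-decompose (NonzeroLast-Unique (suc n)) (NonzeroLast-Unique n) (Decreasing-Unique n) newMaximum (λ _ → true) ⟩
    countᵇ (λ _ → true) (NonzeroLast n) + countᵇ (λ _ → true) (Decreasing n)
      ≡⟨ cong₂ _+_ (countᵇ-all (NonzeroLast n)) (trans (countᵇ-all (Decreasing n)) (sym (count≡countᵇ-Avoiders τ n 1))) ⟩
    length (NonzeroLast n) + count τ n 1                 ∎
    where open ≡-Reasoning

open PowerSeries using (module PascalRecurrence; module CoupledRecurrence; module TriangularRecurrence)

series-123 : F (1 ∷ 2 ∷ 3 ∷ []) ⊗ ((𝟙 ⊖ X) ⊗ (𝟙 ⊖ X) ⊗ (𝟙 ⊖ X))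
             ≐ (𝟙 ⊖ X) ⊗ (𝟙 ⊖ X) ⊗ (𝟙 ⊖ X) ⊕ X ⊗ Q ⊗ (𝟙 ⊖ X) ⊗ (𝟙 ⊖ X) ⊕ X ⊗ X ⊗ Q ⊗ Q
series-123 = TriangularRecurrence.series (count p123) nonzeroLast refl (λ _ → refl) refl refl (λ _ → refl)
  (λ n 1≤n → count-≢2 n 1≤n 0 refl) (λ n 1≤n → count-≢2 n 1≤n 1 refl) count-2
  (λ n 1≤n k → count-≢2 n 1≤n (3 + k) refl) refl nonzeroLast-step
  where
  open Avoiders123 using (count-≢2; count-2; nonzeroLast-step)
  nonzeroLast : ℕ → ℕ
  nonzeroLast = length ∘ Avoiders123.NonzeroLast 1 (s≤s z≤n)

series-132 : F (1 ∷ 3 ∷ 2 ∷ []) ⊗ (𝟙 ⊖ X ⊖ X ⊗ Q) ≐ 𝟙 ⊖ X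
series-132 = PascalRecurrence.series (count p132) refl (λ _ → refl) refl refl (λ _ → refl) Avoiders132.recurrence

series-213 : F (2 ∷ 1 ∷ 3 ∷ []) ⊗ (𝟙 ⊖ X ⊖ X ⊗ Q) ≐ 𝟙 ⊖ X
series-213 = PascalRecurrence.series (count p213) refl (λ _ → refl) refl refl (λ _ → refl) Avoiders213.recurrence

series-231 : F (2 ∷ 3 ∷ 1 ∷ []) ⊗ (𝟙 ⊖ X ⊖ X ⊗ Q) ≐ 𝟙 ⊖ X
series-231 = PascalRecurrence.series (count p231) refl (λ _ → refl) refl refl (λ _ → refl)
  λ { (suc m) _ → Avoiders231.recurrence m }

series-321 : F (3 ∷ 2 ∷ 1 ∷ []) ⊗ ((𝟙 ⊖ X ⊗ Q) ⊗ (𝟙 ⊖ X ⊗ Q) ⊖ X ⊗ X ⊗ Q) ≐ 𝟙 ⊖ X ⊗ Q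
series-321 = CoupledRecurrence.series (count p321) (countDropLast p321) refl (λ _ → refl) refl refl (λ _ → refl)
  refl (λ _ → refl) count-zero count-suc countDropLast-zero countDropLast-suc
  where open Avoiders321 using (count-zero; count-suc; countDropLast-zero; countDropLast-suc)

corollary2p5 :
  -- F_123 · (1-x)^3 = (1-x)^3 + xq(1-x)^2 + x^2 q^2
  (F (1 ∷ 2 ∷ 3 ∷ []) ⊗ ((𝟙 ⊖ X) ⊗ (𝟙 ⊖ X) ⊗ (𝟙 ⊖ X))
    ≐ (𝟙 ⊖ X) ⊗ (𝟙 ⊖ X) ⊗ (𝟙 ⊖ X) ⊕ X ⊗ Q ⊗ (𝟙 ⊖ X) ⊗ (𝟙 ⊖ X) ⊕ X ⊗ X ⊗ Q ⊗ Q)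
  -- F_132 · (1-x-xq) = 1-x
  × (F (1 ∷ 3 ∷ 2 ∷ []) ⊗ (𝟙 ⊖ X ⊖ X ⊗ Q) ≐ 𝟙 ⊖ X)
  -- F_213 · (1-x-xq) = 1-x
  × (F (2 ∷ 1 ∷ 3 ∷ []) ⊗ (𝟙 ⊖ X ⊖ X ⊗ Q) ≐ 𝟙 ⊖ X)
  -- F_231 · (1-x-xq) = 1-x
  × (F (2 ∷ 3 ∷ 1 ∷ []) ⊗ (𝟙 ⊖ X ⊖ X ⊗ Q) ≐ 𝟙 ⊖ X)
  -- F_321 · ((1-xq)^2 - x^2 q) = 1-xq
  × (F (3 ∷ 2 ∷ 1 ∷ []) ⊗ ((𝟙 ⊖ X ⊗ Q) ⊗ (𝟙 ⊖ X ⊗ Q) ⊖ X ⊗ X ⊗ Q) ≐ 𝟙 ⊖ X ⊗ Q)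
corollary2p5 = series-123 , series-132 , series-213 , series-231 , series-321
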